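{- Let $k \in \mathbb{Z}$ and $n \geq 1$. Then \begin{equation*} \begin{split} C_{n}^{(k)}(x)&=\sum_{l=0}^{n-1} \sum_{l_{1}+\cdots + l_{n}=l}\binom{n-1}{l_{1},\cdots , l_{n},n-1-l}\frac{ B_{l_{1}} \cdots B_{l_{n}}}{(n-l+1)^k}\\ & +\sum_{j=1}^{n}\left\{\sum_{l=0}^{n-j}\sum_{l_{1}+\cdots + l_{n}=l}(-1)^{j}\binom{n-1}{l_{1},\cdots , l_{n},n-1-l}\binom{n-l}{j}\frac{ B_{l_{1}} \cdots B_{l_{n}}}{(n-l-j+1)^k}\right\}x^{j}, \end{split} \end{equation*} where the inner sums run over all $n$-tuples of nonnegative integers $(l_1,\dots,l_n)$ with $l_1+\cdots+l_n=l$.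
   Context: For $k\in\mathbb{Z}$ the polylogarithm factorial function is the formal power series $Lif_k(t)=\sum_{m=0}^{\infty}\frac{t^m}{m!(m+1)^k}$. The poly-Cauchy polynomials of the first kind $C_n^{(k)}(x)$ are defined by the generating function $\frac{Lif_k(\log(1+t))}{(1+t)^x}=\sum_{n=0}^\infty C_n^{(k)}(x)\frac{t^n}{n!}$. $B_l$ denotes the $l$-th Bernoulli number, $\frac{t}{e^t-1}=\sum_{l\ge0}B_l\frac{t^l}{l!}$. The multinomial coefficient is $\binom{n-1}{l_1,\dots,l_n,n-1-l}=\frac{(n-1)!}{l_1!\cdots l_n!\,(n-1-l)!}$ for $l=l_1+\cdots+l_n\le n-1$. -}

module Defs where

open import Data.Nat as ℕ using (ℕ; zero; suc; _∸_; _!)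
open import Data.Nat.Combinatorics using (_C_)
open import Data.Integer as ℤ using (ℤ; +_; -[1+_])
open import Data.Rational using (ℚ; mkℚ; 0ℚ; 1ℚ; _+_; _*_; -_; _/_)
open import Data.List as List using (List; []; _∷_; zipWith; upTo; concatMap)
open import Data.Vec as Vec using (Vec; []; _∷_)

ℕtoℚ : ℕ → ℚ
ℕtoℚ n = + n / 1

-- multiplicative inverse, with the (never used) convention 1/0 = 0
invℚ : ℚ → ℚ
invℚ (mkℚ (+ zero) d _)    = 0ℚ
invℚ (mkℚ (+ suc a) d _)   = (+ suc d) / suc a
invℚ (mkℚ -[1+ a ] d _)    = ℤ.- (+ suc d) / suc a

powℚ : ℚ → ℕ → ℚ
powℚ q zero    = 1ℚ
powℚ q (suc m) = q * powℚ q m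

powℤ : ℚ → ℤ → ℚ
powℤ q (+ j)     = powℚ q j
powℤ q -[1+ j ]  = invℚ (powℚ q (suc j))

Σ< : ℕ → (ℕ → ℚ) → ℚ
Σ< zero    f = 0ℚ
Σ< (suc n) f = Σ< n f + f n

sumList : List ℚ → ℚ
sumList = List.foldr _+_ 0ℚ

-- Formal power series over ℚ, represented by their coefficient sequences

PS : Set
PS = ℕ → ℚ

_⊛_ : PS → PS → PS
(f ⊛ g) n = Σ< (suc n) (λ i → f i * g (n ∸ i))

_^ₚ_ : PS → ℕ → PS
(g ^ₚ zero) zero    = 1ℚ
(g ^ₚ zero) (suc n) = 0ℚ
(g ^ₚ suc m)        = g ⊛ (g ^ₚ m)

-- composition f(g(t)), for g with zero constant term:
-- [t^n] f(g) = Σ_{m=0}^{n} f_m [t^n] g^m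
_∘ₚ_ : PS → PS → PS
(f ∘ₚ g) n = Σ< (suc n) (λ m → f m * (g ^ₚ m) n)

-- multiplicative inverse of a series with nonzero constant term.
-- invRev c n = [b_n , b_{n-1} , … , b_0]  where  Σ_i b_i t^i = 1 / Σ_i c_i t^i
invRev : PS → ℕ → List ℚ
invRev c zero    = invℚ (c 0) ∷ []
invRev c (suc n) =
  (- (invℚ (c 0) * sumList (zipWith _*_ (List.map (λ i → c (suc i)) (upTo (suc n))) r))) ∷ r
  where r = invRev c n

headℚ : List ℚ → ℚ
headℚ []      = 0ℚ
headℚ (q ∷ _) = q

invPS : PS → PS
invPS c n = headℚ (invRev c n)

Lif : ℤ → PS
Lif k m = invℚ (ℕtoℚ (m !) * powℤ (ℕtoℚ (suc m)) k)

log1+t : PS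
log1+t zero    = 0ℚ
log1+t (suc n) = powℚ (- 1ℚ) n * invℚ (ℕtoℚ (suc n))

-- (1+t)^a = Σ_n binom(a,n) t^n  (generalised binomial series, a ∈ ℚ)
fallingℚ : ℚ → ℕ → ℚ
fallingℚ a zero    = 1ℚ
fallingℚ a (suc n) = fallingℚ a n * (a + - ℕtoℚ n)

binomPS : ℚ → PS
binomPS a n = fallingℚ a n * invℚ (ℕtoℚ (n !))

expm1/t : PS
expm1/t n = invℚ (ℕtoℚ (suc n !))

-- Bernoulli numbers:  t/(e^t-1) = Σ_l B_l t^l / l!
B : ℕ → ℚ
B l = ℕtoℚ (l !) * invPS expm1/t l

-- poly-Cauchy polynomials of the first kind, evaluated at x ∈ ℚ:
-- Lif_k(log(1+t)) / (1+t)^x = Σ_n C_n^{(k)}(x) t^n / n!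
C⁽_⁾ : ℤ → ℕ → ℚ → ℚ
C⁽ k ⁾ n x = ℕtoℚ (n !) * ((Lif k ∘ₚ log1+t) ⊛ binomPS (- x)) n

tuples : (n l : ℕ) → List (Vec ℕ n)
tuples zero    zero    = [] ∷ []
tuples zero    (suc l) = []
tuples (suc n) l = concatMap (λ a → List.map (a ∷_) (tuples n (l ∸ a))) (upTo (suc l))

prodFact : ∀ {n} → Vec ℕ n → ℕ
prodFact = Vec.foldr _ (λ a r → a ! ℕ.* r) 1

prodB : ∀ {n} → Vec ℕ n → ℚ
prodB = Vec.foldr _ (λ a r → B a * r) 1ℚ

multinom : ∀ {n} → ℕ → Vec ℕ n → ℕ → ℚ
multinom N ls r = ℕtoℚ (N !) * invℚ (ℕtoℚ (prodFact ls ℕ.* (r !)))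

sign : ℕ → ℚ
sign j = powℚ (- 1ℚ) j

rhsConst : ℤ → ℕ → ℚ
rhsConst k n =
  Σ< n (λ l → sumList (List.map
    (λ ls → multinom (n ∸ 1) ls (n ∸ 1 ∸ l) * prodB ls * invℚ (powℤ (ℕtoℚ (n ∸ l ℕ.+ 1)) k))
    (tuples n l)))

rhsCoeff : ℤ → ℕ → ℕ → ℚ
rhsCoeff k n j =
  Σ< (n ∸ j ℕ.+ 1) (λ l → sumList (List.map
    (λ ls → sign j * multinom (n ∸ 1) ls (n ∸ 1 ∸ l) * ℕtoℚ ((n ∸ l) C j) * prodB ls
            * invℚ (powℤ (ℕtoℚ (n ∸ l ∸ j ℕ.+ 1)) k))
    (tuples n l)))

rhs : ℤ → ℕ → ℚ → ℚ
rhs k n x = rhsConst k n + Σ< n (λ i → rhsCoeff k n (suc i) * powℚ x (suc i))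

-- Both sides are linear in the sequence c_m = m! Lif_k(m) = 1/(m+1)ᵏ.  The left side is
-- Σ_m c_m (n!/m!) [tⁿ] log(1+t)ᵐ (1+t)^(−x), and applying the operator (1+t) t d/dt to
-- log(1+t)ᵐ (1+t)^(−x) turns it into the recurrence F(c, n+1) = F(c ∘ suc, n) − (x + n) F(c, n).
-- By the Stirling and Pascal recurrences, Σ_M s(n,M) Σ_j C(M,j) (−x)ʲ c_{M−j}, with s the signed
-- Stirling numbers of the first kind, satisfies the same recurrence, so the two agree.  On the other
-- hand β = t/(eᵗ − 1) satisfies t β′ = β − t β − β², which yields p! [tˡ] β^(p+1) = (p−l)! s(p+1, p+1−l);
-- this identifies the multinomial sums of Bernoulli numbers on the right-hand side with s(n, n−l), and
-- reversing and regrouping the Stirling sum gives the stated formula.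

module Submission where

open import Defs
open import Data.Nat as ℕ using (ℕ; zero; suc; _!; _∸_; _≤_; _<_)
open import Data.Nat.Combinatorics using (_C_; nCk+nC[k+1]≡[n+1]C[k+1]; k>n⇒nCk≡0)
import Data.Nat.Properties as ℕ
open import Data.Integer as ℤ using (ℤ; -[1+_])
import Data.Integer.Properties as ℤ
import Data.Nat.Coprimality as Coprime
open import Data.Rational using (ℚ; mkℚ; 0ℚ; 1ℚ; _+_; _*_; -_; _-_; _/_; 1/_; NonZero; *≡*)
open import Data.Rational.Properties
open import Data.Rational.Solver using (module +-*-Solver)
open import Data.List as List using (List; []; _∷_; _++_; zipWith; upTo; applyUpTo; concatMap)
import Data.List.Properties as List
open import Data.Vec as Vec using (Vec; []; _∷_)
open import Data.Empty using (⊥-elim)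
open import Relation.Nullary using (yes; no)
open import Relation.Binary.PropositionalEquality
open +-*-Solver

ℕtoℚ≡mkℚ : ∀ n → ℕtoℚ n ≡ mkℚ (ℤ.+ n) 0 (Coprime.sym (Coprime.1-coprimeTo n))
ℕtoℚ≡mkℚ n = normalize-coprime (Coprime.sym (Coprime.1-coprimeTo n))

ℕtoℚ-homo-+ : ∀ m n → ℕtoℚ (m ℕ.+ n) ≡ ℕtoℚ m + ℕtoℚ n
ℕtoℚ-homo-+ m n = trans (cong (_/ 1) num) (sym (cong₂ _+_ (ℕtoℚ≡mkℚ m) (ℕtoℚ≡mkℚ n)))
  where
  num : ℤ.+ (m ℕ.+ n) ≡ (ℤ.+ m ℤ.* ℤ.+ 1) ℤ.+ (ℤ.+ n ℤ.* ℤ.+ 1)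
  num = trans (ℤ.pos-+ m n) (sym (cong₂ ℤ._+_ (ℤ.*-identityʳ (ℤ.+ m)) (ℤ.*-identityʳ (ℤ.+ n))))

ℕtoℚ-homo-* : ∀ m n → ℕtoℚ (m ℕ.* n) ≡ ℕtoℚ m * ℕtoℚ n
ℕtoℚ-homo-* m n = trans (cong (_/ 1) (ℤ.pos-* m n)) (sym (cong₂ _*_ (ℕtoℚ≡mkℚ m) (ℕtoℚ≡mkℚ n)))

ℕtoℚ-suc : ∀ n → ℕtoℚ (suc n) ≡ 1ℚ + ℕtoℚ n
ℕtoℚ-suc = ℕtoℚ-homo-+ 1

ℕtoℚ-suc≢0 : ∀ n → ℕtoℚ (suc n) ≢ 0ℚ
ℕtoℚ-suc≢0 n eq with trans (sym (ℕtoℚ≡mkℚ (suc n))) eq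
... | ()

ℕtoℚ-!≢0 : ∀ n → ℕtoℚ (n !) ≢ 0ℚ
ℕtoℚ-!≢0 n with n ! | ℕ.1≤n! n
... | suc m | _ = ℕtoℚ-suc≢0 m

invℚ≡1/ : ∀ q .{{_ : NonZero q}} → invℚ q ≡ 1/ q
invℚ≡1/ (mkℚ (ℤ.+ suc a) d c) = normalize-coprime (Coprime.sym c)
invℚ≡1/ (mkℚ -[1+ a ] d c)    = cong -_ (normalize-coprime (Coprime.sym c))

*-invℚʳ : ∀ q → q ≢ 0ℚ → q * invℚ q ≡ 1ℚ
*-invℚʳ (mkℚ (ℤ.+ zero) d c)      q≢0 = ⊥-elim (q≢0 (≃⇒≡ (*≡* refl)))
*-invℚʳ q@(mkℚ (ℤ.+ suc a) d c) _   = trans (cong (q *_) (invℚ≡1/ q)) (*-inverseʳ q)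
*-invℚʳ q@(mkℚ -[1+ a ] d c)    _   = trans (cong (q *_) (invℚ≡1/ q)) (*-inverseʳ q)

*-invℚˡ : ∀ q → q ≢ 0ℚ → invℚ q * q ≡ 1ℚ
*-invℚˡ q q≢0 = trans (*-comm (invℚ q) q) (*-invℚʳ q q≢0)

*-≢0 : ∀ p q → p ≢ 0ℚ → q ≢ 0ℚ → p * q ≢ 0ℚ
*-≢0 p q p≢0 q≢0 pq≡0 = q≢0 (begin
  q                   ≡⟨ sym (*-identityˡ q) ⟩
  1ℚ * q              ≡⟨ cong (_* q) (*-invℚˡ p p≢0) ⟨
  (invℚ p * p) * q    ≡⟨ *-assoc (invℚ p) p q ⟩
  invℚ p * (p * q)    ≡⟨ cong (invℚ p *_) pq≡0 ⟩
  invℚ p * 0ℚ         ≡⟨ *-zeroʳ (invℚ p) ⟩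
  0ℚ                  ∎)
  where open ≡-Reasoning

-- Also holds when p or q is zero, thanks to the convention invℚ 0ℚ ≡ 0ℚ.
invℚ-* : ∀ p q → invℚ (p * q) ≡ invℚ p * invℚ q
invℚ-* p q with p ≟ 0ℚ | q ≟ 0ℚ
... | yes refl | _        = trans (cong invℚ (*-zeroˡ q)) (sym (*-zeroˡ (invℚ q)))
... | no _     | yes refl = trans (cong invℚ (*-zeroʳ p)) (sym (*-zeroʳ (invℚ p)))
... | no p≢0   | no q≢0   = begin
  invℚ (p * q)                                     ≡⟨ solve 1 (λ a → a := a :* con 1ℚ :* con 1ℚ) refl (invℚ (p * q)) ⟩
  invℚ (p * q) * 1ℚ * 1ℚ                           ≡⟨ cong₂ (λ a b → invℚ (p * q) * a * b) (*-invℚʳ p p≢0) (*-invℚʳ q q≢0) ⟨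
  invℚ (p * q) * (p * invℚ p) * (q * invℚ q)       ≡⟨ solve 5 (λ a b c d e → a :* (b :* c) :* (d :* e) := ((b :* d) :* a) :* (c :* e))
                                                        refl (invℚ (p * q)) p (invℚ p) q (invℚ q) ⟩
  ((p * q) * invℚ (p * q)) * (invℚ p * invℚ q)     ≡⟨ cong (_* (invℚ p * invℚ q)) (*-invℚʳ (p * q) (*-≢0 p q p≢0 q≢0)) ⟩
  1ℚ * (invℚ p * invℚ q)                           ≡⟨ *-identityˡ _ ⟩
  invℚ p * invℚ q                                  ∎
  where open ≡-Reasoning

[1+m]*invℚ[1+m]!≡invℚm! : ∀ m → ℕtoℚ (suc m) * invℚ (ℕtoℚ (suc m !)) ≡ invℚ (ℕtoℚ (m !))
[1+m]*invℚ[1+m]!≡invℚm! m = begin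
  a * invℚ (ℕtoℚ (suc m ℕ.* m !))  ≡⟨ cong (λ z → a * invℚ z) (ℕtoℚ-homo-* (suc m) (m !)) ⟩
  a * invℚ (a * F)                 ≡⟨ cong (a *_) (invℚ-* a F) ⟩
  a * (invℚ a * invℚ F)            ≡⟨ *-assoc a (invℚ a) (invℚ F) ⟨
  (a * invℚ a) * invℚ F            ≡⟨ cong (_* invℚ F) (*-invℚʳ a (ℕtoℚ-suc≢0 m)) ⟩
  1ℚ * invℚ F                      ≡⟨ *-identityˡ _ ⟩
  invℚ F                           ∎
  where
  open ≡-Reasoning
  a = ℕtoℚ (suc m)
  F = ℕtoℚ (m !)

Σ<-cong : ∀ n {f g : ℕ → ℚ} → (∀ i → i < n → f i ≡ g i) → Σ< n f ≡ Σ< n g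
Σ<-cong zero    eq = refl
Σ<-cong (suc n) eq = cong₂ _+_ (Σ<-cong n (λ i i<n → eq i (ℕ.m<n⇒m<1+n i<n))) (eq n ℕ.≤-refl)

Σ<-cong′ : ∀ n {f g : ℕ → ℚ} → f ≗ g → Σ< n f ≡ Σ< n g
Σ<-cong′ n eq = Σ<-cong n (λ i _ → eq i)

Σ<-zero : ∀ n (f : ℕ → ℚ) → (∀ i → i < n → f i ≡ 0ℚ) → Σ< n f ≡ 0ℚ
Σ<-zero zero    f eq = refl
Σ<-zero (suc n) f eq = cong₂ _+_ (Σ<-zero n f (λ i i<n → eq i (ℕ.m<n⇒m<1+n i<n))) (eq n ℕ.≤-refl)

Σ<-distrib-+ : ∀ n (f g : ℕ → ℚ) → Σ< n (λ i → f i + g i) ≡ Σ< n f + Σ< n g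
Σ<-distrib-+ zero    f g = refl
Σ<-distrib-+ (suc n) f g = trans (cong (_+ (f n + g n)) (Σ<-distrib-+ n f g))
  (solve 4 (λ a b c d → (a :+ b) :+ (c :+ d) := (a :+ c) :+ (b :+ d)) refl (Σ< n f) (Σ< n g) (f n) (g n))

Σ<-*ˡ : ∀ n c (f : ℕ → ℚ) → Σ< n (λ i → c * f i) ≡ c * Σ< n f
Σ<-*ˡ zero    c f = sym (*-zeroʳ c)
Σ<-*ˡ (suc n) c f = trans (cong (_+ (c * f n)) (Σ<-*ˡ n c f)) (sym (*-distribˡ-+ c (Σ< n f) (f n)))

Σ<-*ʳ : ∀ n c (f : ℕ → ℚ) → Σ< n (λ i → f i * c) ≡ Σ< n f * c
Σ<-*ʳ n c f = trans (Σ<-cong′ n (λ i → *-comm (f i) c)) (trans (Σ<-*ˡ n c f) (*-comm c _))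

Σ<-linear₃ : ∀ n a b c (f g h : ℕ → ℚ) →
             Σ< n (λ i → a * f i + b * g i + c * h i) ≡ a * Σ< n f + b * Σ< n g + c * Σ< n h
Σ<-linear₃ zero    a b c f g h = solve 3 (λ a b c → con 0ℚ := a :* con 0ℚ :+ b :* con 0ℚ :+ c :* con 0ℚ) refl a b c
Σ<-linear₃ (suc n) a b c f g h = trans (cong (_+ (a * f n + b * g n + c * h n)) (Σ<-linear₃ n a b c f g h))
  (solve 9 (λ a b c x y z u v w → a :* x :+ b :* y :+ c :* z :+ (a :* u :+ b :* v :+ c :* w)
                                   := a :* (x :+ u) :+ b :* (y :+ v) :+ c :* (z :+ w))
     refl a b c (Σ< n f) (Σ< n g) (Σ< n h) (f n) (g n) (h n))

Σ<-head : ∀ n (f : ℕ → ℚ) → Σ< (suc n) f ≡ f 0 + Σ< n (λ i → f (suc i))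
Σ<-head zero    f = trans (+-identityˡ (f 0)) (sym (+-identityʳ (f 0)))
Σ<-head (suc n) f = trans (cong (_+ f (suc n)) (Σ<-head n f)) (+-assoc (f 0) _ _)

Σ<-head-vanish : ∀ n (f : ℕ → ℚ) → f (suc n) ≡ 0ℚ → f 0 + Σ< (suc n) (λ i → f (suc i)) ≡ Σ< (suc n) f
Σ<-head-vanish n f last≡0 = trans (sym (Σ<-head (suc n) f)) (trans (cong (Σ< (suc n) f +_) last≡0) (+-identityʳ _))

Σ<-comm : ∀ m n (h : ℕ → ℕ → ℚ) → Σ< m (λ i → Σ< n (h i)) ≡ Σ< n (λ j → Σ< m (λ i → h i j))
Σ<-comm zero    n h = sym (Σ<-zero n _ (λ _ _ → refl))
Σ<-comm (suc m) n h = trans (cong (_+ Σ< n (h m)) (Σ<-comm m n h)) (sym (Σ<-distrib-+ n (λ j → Σ< m (λ i → h i j)) (h m)))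

Σ<-extend : ∀ m n (f : ℕ → ℚ) → m ≤ n → (∀ j → m ≤ j → f j ≡ 0ℚ) → Σ< n f ≡ Σ< m f
Σ<-extend m n f m≤n vanish = trans (cong (λ z → Σ< z f) (sym (ℕ.m+[n∸m]≡n m≤n))) (extend (n ∸ m))
  where
  extend : ∀ d → Σ< (m ℕ.+ d) f ≡ Σ< m f
  extend zero    = cong (λ z → Σ< z f) (ℕ.+-identityʳ m)
  extend (suc d) = begin
    Σ< (m ℕ.+ suc d) f            ≡⟨ cong (λ z → Σ< z f) (ℕ.+-suc m d) ⟩
    Σ< (m ℕ.+ d) f + f (m ℕ.+ d)  ≡⟨ cong₂ _+_ (extend d) (vanish (m ℕ.+ d) (ℕ.m≤m+n m d)) ⟩
    Σ< m f + 0ℚ                   ≡⟨ +-identityʳ _ ⟩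
    Σ< m f                        ∎
    where open ≡-Reasoning

Σ<-reverse : ∀ n (f : ℕ → ℚ) → Σ< n f ≡ Σ< n (λ i → f (n ∸ suc i))
Σ<-reverse zero    f = refl
Σ<-reverse (suc n) f = begin
  Σ< n f + f n                               ≡⟨ cong (_+ f n) (Σ<-reverse n f) ⟩
  Σ< n (λ i → f (n ∸ suc i)) + f n           ≡⟨ +-comm _ (f n) ⟩
  f n + Σ< n (λ i → f (n ∸ suc i))           ≡⟨ Σ<-head n (λ i → f (n ∸ i)) ⟨
  Σ< (suc n) (λ i → f (n ∸ i))               ∎
  where open ≡-Reasoning

Σ<-triangle-comm : ∀ n (h : ℕ → ℕ → ℚ) →
                   Σ< n (λ i → Σ< (n ∸ i) (h i)) ≡ Σ< n (λ j → Σ< (n ∸ j) (λ i → h i j))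
Σ<-triangle-comm zero    h = refl
Σ<-triangle-comm (suc n) h = begin
  Σ< (suc n) (λ i → Σ< (suc n ∸ i) (h i))
    ≡⟨ Σ<-cong (suc n) (λ i i≤n → trans (cong (λ z → Σ< z (h i)) (ℕ.+-∸-assoc 1 (ℕ.≤-pred i≤n))) (Σ<-head (n ∸ i) (h i))) ⟩
  Σ< (suc n) (λ i → h i 0 + Σ< (n ∸ i) (λ j → h i (suc j)))
    ≡⟨ Σ<-distrib-+ (suc n) (λ i → h i 0) _ ⟩
  Σ< (suc n) (λ i → h i 0) + (Σ< n (λ i → Σ< (n ∸ i) (λ j → h i (suc j))) + Σ< (n ∸ n) (λ j → h n (suc j)))
    ≡⟨ cong (λ z → Σ< (suc n) (λ i → h i 0) + (Σ< n (λ i → Σ< (n ∸ i) (λ j → h i (suc j))) + Σ< z (λ j → h n (suc j))))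
            (ℕ.n∸n≡0 n) ⟩
  Σ< (suc n) (λ i → h i 0) + (Σ< n (λ i → Σ< (n ∸ i) (λ j → h i (suc j))) + 0ℚ)
    ≡⟨ cong (λ z → Σ< (suc n) (λ i → h i 0) + z) (trans (+-identityʳ _) (Σ<-triangle-comm n (λ i j → h i (suc j)))) ⟩
  Σ< (suc n) (λ i → h i 0) + Σ< n (λ j → Σ< (n ∸ j) (λ i → h i (suc j)))
    ≡⟨ Σ<-head n (λ j → Σ< (suc n ∸ j) (λ i → h i j)) ⟨
  Σ< (suc n) (λ j → Σ< (suc n ∸ j) (λ i → h i j))
    ∎
  where open ≡-Reasoning

Σ<-triangle-reindex : ∀ n (h : ℕ → ℕ → ℚ) →
                      Σ< n (λ i → Σ< (suc i) (λ a → h a i)) ≡ Σ< n (λ a → Σ< (n ∸ a) (λ b → h a (a ℕ.+ b)))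
Σ<-triangle-reindex zero    h = refl
Σ<-triangle-reindex (suc n) h = begin
  Σ< n (λ i → Σ< (suc i) (λ a → h a i)) + Σ< (suc n) (λ a → h a n)
    ≡⟨ cong (_+ Σ< (suc n) (λ a → h a n)) (Σ<-triangle-reindex n h) ⟩
  Σ< n (λ a → Σ< (n ∸ a) (λ b → h a (a ℕ.+ b))) + Σ< (suc n) (λ a → h a n)
    ≡⟨ cong (λ z → z + Σ< (suc n) (λ a → h a n))
            (sym (trans (cong (λ z → Σ< n (λ a → Σ< (n ∸ a) (λ b → h a (a ℕ.+ b))) + Σ< z (λ b → h n (n ℕ.+ b))) (ℕ.n∸n≡0 n))
                        (+-identityʳ (Σ< n (λ a → Σ< (n ∸ a) (λ b → h a (a ℕ.+ b))))))) ⟩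
  Σ< (suc n) (λ a → Σ< (n ∸ a) (λ b → h a (a ℕ.+ b))) + Σ< (suc n) (λ a → h a n)
    ≡⟨ Σ<-distrib-+ (suc n) _ _ ⟨
  Σ< (suc n) (λ a → Σ< (n ∸ a) (λ b → h a (a ℕ.+ b)) + h a n)
    ≡⟨ Σ<-cong (suc n) (λ a a≤n → sym (trans (cong (λ z → Σ< z (λ b → h a (a ℕ.+ b))) (ℕ.+-∸-assoc 1 (ℕ.≤-pred a≤n)))
                                             (cong (Σ< (n ∸ a) (λ b → h a (a ℕ.+ b)) +_) (cong (h a) (ℕ.m+[n∸m]≡n (ℕ.≤-pred a≤n)))))) ⟩
  Σ< (suc n) (λ a → Σ< (suc n ∸ a) (λ b → h a (a ℕ.+ b)))
    ∎
  where open ≡-Reasoning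

1ₚ : PS
1ₚ zero    = 1ℚ
1ₚ (suc n) = 0ℚ

shift : PS → PS
shift f zero    = 0ℚ
shift f (suc n) = f n

θ : PS → PS
θ f n = ℕtoℚ n * f n

[1+t]θ : PS → PS
[1+t]θ f n = θ f n + shift (θ f) n

^ₚ-zero : ∀ g → (g ^ₚ 0) ≗ 1ₚ
^ₚ-zero g zero    = refl
^ₚ-zero g (suc n) = refl

shift-cong : ∀ {f g : PS} → f ≗ g → shift f ≗ shift g
shift-cong eq zero    = refl
shift-cong eq (suc n) = eq n

θ-1ₚ : ∀ n → θ 1ₚ n ≡ 0ℚ
θ-1ₚ zero    = refl
θ-1ₚ (suc n) = *-zeroʳ (ℕtoℚ (suc n))

⊛-cong : ∀ {f f′ g g′ : PS} → f ≗ f′ → g ≗ g′ → f ⊛ g ≗ f′ ⊛ g′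
⊛-cong f≗f′ g≗g′ n = Σ<-cong′ (suc n) (λ i → cong₂ _*_ (f≗f′ i) (g≗g′ (n ∸ i)))

⊛-congˡ : ∀ {f f′ : PS} (g : PS) → f ≗ f′ → f ⊛ g ≗ f′ ⊛ g
⊛-congˡ g f≗f′ = ⊛-cong {g = g} {g′ = g} f≗f′ (λ _ → refl)

⊛-congʳ : ∀ (f : PS) {g g′ : PS} → g ≗ g′ → f ⊛ g ≗ f ⊛ g′
⊛-congʳ f = ⊛-cong {f = f} {f′ = f} (λ _ → refl)

⊛-comm : ∀ (f g : PS) → f ⊛ g ≗ g ⊛ f
⊛-comm f g n = trans (Σ<-reverse (suc n) (λ i → f i * g (n ∸ i)))
  (Σ<-cong (suc n) (λ i i≤n → trans (cong (λ z → f (n ∸ i) * g z) (ℕ.m∸[m∸n]≡n (ℕ.≤-pred i≤n))) (*-comm (f (n ∸ i)) (g i))))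

⊛-assoc : ∀ (f g h : PS) → (f ⊛ g) ⊛ h ≗ f ⊛ (g ⊛ h)
⊛-assoc f g h n = begin
  Σ< (suc n) (λ i → Σ< (suc i) (λ a → f a * g (i ∸ a)) * h (n ∸ i))
    ≡⟨ Σ<-cong′ (suc n) (λ i → sym (Σ<-*ʳ (suc i) (h (n ∸ i)) (λ a → f a * g (i ∸ a)))) ⟩
  Σ< (suc n) (λ i → Σ< (suc i) (λ a → f a * g (i ∸ a) * h (n ∸ i)))
    ≡⟨ Σ<-triangle-reindex (suc n) (λ a i → f a * g (i ∸ a) * h (n ∸ i)) ⟩
  Σ< (suc n) (λ a → Σ< (suc n ∸ a) (λ b → f a * g (a ℕ.+ b ∸ a) * h (n ∸ (a ℕ.+ b))))
    ≡⟨ Σ<-cong (suc n) inner ⟩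
  Σ< (suc n) (λ a → f a * Σ< (suc (n ∸ a)) (λ b → g b * h (n ∸ a ∸ b)))
    ∎
  where
  open ≡-Reasoning
  inner : ∀ a → a < suc n → Σ< (suc n ∸ a) (λ b → f a * g (a ℕ.+ b ∸ a) * h (n ∸ (a ℕ.+ b)))
                          ≡ f a * Σ< (suc (n ∸ a)) (λ b → g b * h (n ∸ a ∸ b))
  inner a a≤n = begin
    Σ< (suc n ∸ a) (λ b → f a * g (a ℕ.+ b ∸ a) * h (n ∸ (a ℕ.+ b)))
      ≡⟨ cong (λ z → Σ< z (λ b → f a * g (a ℕ.+ b ∸ a) * h (n ∸ (a ℕ.+ b)))) (ℕ.+-∸-assoc 1 (ℕ.≤-pred a≤n)) ⟩
    Σ< (suc (n ∸ a)) (λ b → f a * g (a ℕ.+ b ∸ a) * h (n ∸ (a ℕ.+ b)))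
      ≡⟨ Σ<-cong′ (suc (n ∸ a)) (λ b → trans (cong₂ (λ u v → f a * g u * h v) (ℕ.m+n∸m≡n a b) (sym (ℕ.∸-+-assoc n a b)))
                                             (*-assoc (f a) _ _)) ⟩
    Σ< (suc (n ∸ a)) (λ b → f a * (g b * h (n ∸ a ∸ b)))
      ≡⟨ Σ<-*ˡ (suc (n ∸ a)) (f a) (λ b → g b * h (n ∸ a ∸ b)) ⟩
    f a * Σ< (suc (n ∸ a)) (λ b → g b * h (n ∸ a ∸ b))
      ∎

⊛-distribˡ-+ : ∀ (f g h : PS) n → (f ⊛ (λ i → g i + h i)) n ≡ (f ⊛ g) n + (f ⊛ h) n
⊛-distribˡ-+ f g h n = trans (Σ<-cong′ (suc n) (λ i → *-distribˡ-+ (f i) (g (n ∸ i)) (h (n ∸ i))))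
                             (Σ<-distrib-+ (suc n) (λ i → f i * g (n ∸ i)) (λ i → f i * h (n ∸ i)))

⊛-distribʳ-+ : ∀ (f g h : PS) n → ((λ i → f i + g i) ⊛ h) n ≡ (f ⊛ h) n + (g ⊛ h) n
⊛-distribʳ-+ f g h n = trans (Σ<-cong′ (suc n) (λ i → *-distribʳ-+ (h (n ∸ i)) (f i) (g i)))
                             (Σ<-distrib-+ (suc n) (λ i → f i * h (n ∸ i)) (λ i → g i * h (n ∸ i)))

⊛-*ˡ : ∀ c (f g : PS) n → ((λ i → c * f i) ⊛ g) n ≡ c * (f ⊛ g) n
⊛-*ˡ c f g n = trans (Σ<-cong′ (suc n) (λ i → *-assoc c _ _)) (Σ<-*ˡ (suc n) c _)

⊛-*ʳ : ∀ c (f g : PS) n → (f ⊛ (λ i → c * g i)) n ≡ c * (f ⊛ g) n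
⊛-*ʳ c f g n = trans (Σ<-cong′ (suc n) (λ i → solve 3 (λ a b x → a :* (x :* b) := x :* (a :* b)) refl (f i) (g (n ∸ i)) c))
                     (Σ<-*ˡ (suc n) c _)

⊛-linear₃ˡ : ∀ a b c (f g h k : PS) n →
             ((λ i → a * f i + b * g i + c * h i) ⊛ k) n ≡ a * (f ⊛ k) n + b * (g ⊛ k) n + c * (h ⊛ k) n
⊛-linear₃ˡ a b c f g h k n = trans
  (Σ<-cong′ (suc n) (λ i → solve 7 (λ a b c x y z w → (a :* y :+ b :* z :+ c :* w) :* x := a :* (y :* x) :+ b :* (z :* x) :+ c :* (w :* x))
                              refl a b c (k (n ∸ i)) (f i) (g i) (h i)))
  (Σ<-linear₃ (suc n) a b c _ _ _)

⊛-linear₃ʳ : ∀ a b c (f g h k : PS) n →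
             (k ⊛ (λ i → a * f i + b * g i + c * h i)) n ≡ a * (k ⊛ f) n + b * (k ⊛ g) n + c * (k ⊛ h) n
⊛-linear₃ʳ a b c f g h k n = trans
  (Σ<-cong′ (suc n) (λ i → solve 7 (λ a b c x y z w → x :* (a :* y :+ b :* z :+ c :* w) := a :* (x :* y) :+ b :* (x :* z) :+ c :* (x :* w))
                              refl a b c (k i) (f (n ∸ i)) (g (n ∸ i)) (h (n ∸ i))))
  (Σ<-linear₃ (suc n) a b c _ _ _)

⊛-zeroʳ : ∀ (f : PS) → f ⊛ (λ _ → 0ℚ) ≗ λ _ → 0ℚ
⊛-zeroʳ f n = Σ<-zero (suc n) _ (λ i _ → *-zeroʳ (f i))

⊛-identityˡ : ∀ (f : PS) → 1ₚ ⊛ f ≗ f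
⊛-identityˡ f n = trans (Σ<-head n (λ i → 1ₚ i * f (n ∸ i)))
  (trans (cong₂ _+_ (*-identityˡ (f n)) (Σ<-zero n _ (λ i _ → *-zeroˡ (f (n ∸ suc i))))) (+-identityʳ (f n)))

⊛-identityʳ : ∀ (f : PS) → f ⊛ 1ₚ ≗ f
⊛-identityʳ f n = trans (⊛-comm f 1ₚ n) (⊛-identityˡ f n)

shift-⊛ˡ : ∀ (f g : PS) → shift f ⊛ g ≗ shift (f ⊛ g)
shift-⊛ˡ f g zero    = trans (+-identityˡ (0ℚ * g 0)) (*-zeroˡ (g 0))
shift-⊛ˡ f g (suc n) = trans (Σ<-head (suc n) (λ i → shift f i * g (suc n ∸ i)))
  (trans (cong (_+ (f ⊛ g) n) (*-zeroˡ (g (suc n)))) (+-identityˡ ((f ⊛ g) n)))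

shift-⊛ʳ : ∀ (f g : PS) → f ⊛ shift g ≗ shift (f ⊛ g)
shift-⊛ʳ f g n = trans (⊛-comm f (shift g) n) (trans (shift-⊛ˡ g f n) (shift-cong (⊛-comm g f) n))

θ-Leibniz : ∀ (f g : PS) n → θ (f ⊛ g) n ≡ (θ f ⊛ g) n + (f ⊛ θ g) n
θ-Leibniz f g n = begin
  ℕtoℚ n * Σ< (suc n) (λ i → f i * g (n ∸ i))
    ≡⟨ Σ<-*ˡ (suc n) (ℕtoℚ n) _ ⟨
  Σ< (suc n) (λ i → ℕtoℚ n * (f i * g (n ∸ i)))
    ≡⟨ Σ<-cong (suc n) split ⟩
  Σ< (suc n) (λ i → ℕtoℚ i * f i * g (n ∸ i) + f i * (ℕtoℚ (n ∸ i) * g (n ∸ i)))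
    ≡⟨ Σ<-distrib-+ (suc n) _ _ ⟩
  (θ f ⊛ g) n + (f ⊛ θ g) n
    ∎
  where
  open ≡-Reasoning
  split : ∀ i → i < suc n → ℕtoℚ n * (f i * g (n ∸ i)) ≡ ℕtoℚ i * f i * g (n ∸ i) + f i * (ℕtoℚ (n ∸ i) * g (n ∸ i))
  split i i≤n = begin
    ℕtoℚ n * (f i * g (n ∸ i))                  ≡⟨ cong (λ z → ℕtoℚ z * (f i * g (n ∸ i))) (ℕ.m+[n∸m]≡n (ℕ.≤-pred i≤n)) ⟨
    ℕtoℚ (i ℕ.+ (n ∸ i)) * (f i * g (n ∸ i))    ≡⟨ cong (_* (f i * g (n ∸ i))) (ℕtoℚ-homo-+ i (n ∸ i)) ⟩
    (ℕtoℚ i + ℕtoℚ (n ∸ i)) * (f i * g (n ∸ i)) ≡⟨ solve 4 (λ a b u v → (a :+ b) :* (u :* v) := a :* u :* v :+ u :* (b :* v))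
                                                     refl (ℕtoℚ i) (ℕtoℚ (n ∸ i)) (f i) (g (n ∸ i)) ⟩
    ℕtoℚ i * f i * g (n ∸ i) + f i * (ℕtoℚ (n ∸ i) * g (n ∸ i)) ∎

[1+t]θ-Leibniz : ∀ (f g : PS) n → [1+t]θ (f ⊛ g) n ≡ ([1+t]θ f ⊛ g) n + (f ⊛ [1+t]θ g) n
[1+t]θ-Leibniz f g n = begin
  θ (f ⊛ g) n + shift (θ (f ⊛ g)) n
    ≡⟨ cong₂ _+_ (θ-Leibniz f g n) (trans (shift-cong (θ-Leibniz f g) n) (shift-+ n)) ⟩
  (θf⊛g n + f⊛θg n) + (shift θf⊛g n + shift f⊛θg n)
    ≡⟨ solve 4 (λ a b c d → (a :+ b) :+ (c :+ d) := (a :+ c) :+ (b :+ d)) refl (θf⊛g n) (f⊛θg n) (shift θf⊛g n) (shift f⊛θg n) ⟩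
  (θf⊛g n + shift θf⊛g n) + (f⊛θg n + shift f⊛θg n)
    ≡⟨ cong₂ _+_ (trans (⊛-distribʳ-+ (θ f) (shift (θ f)) g n) (cong (θf⊛g n +_) (shift-⊛ˡ (θ f) g n)))
                 (trans (⊛-distribˡ-+ f (θ g) (shift (θ g)) n) (cong (f⊛θg n +_) (shift-⊛ʳ f (θ g) n))) ⟨
  ([1+t]θ f ⊛ g) n + (f ⊛ [1+t]θ g) n
    ∎
  where
  open ≡-Reasoning
  θf⊛g f⊛θg : PS
  θf⊛g = θ f ⊛ g
  f⊛θg = f ⊛ θ g
  shift-+ : ∀ n → shift (λ i → θf⊛g i + f⊛θg i) n ≡ shift θf⊛g n + shift f⊛θg n
  shift-+ zero    = refl
  shift-+ (suc n) = refl

sumList-zipWith-* : ∀ (f g : ℕ → ℚ) n → sumList (zipWith _*_ (applyUpTo f n) (applyUpTo g n)) ≡ Σ< n (λ i → f i * g i)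
sumList-zipWith-* f g zero    = refl
sumList-zipWith-* f g (suc n) = trans (cong (f 0 * g 0 +_) (sumList-zipWith-* (λ i → f (suc i)) (λ i → g (suc i)) n))
                                      (sym (Σ<-head n (λ i → f i * g i)))

invRev≡applyUpTo : ∀ (c : PS) n → invRev c n ≡ applyUpTo (λ i → invPS c (n ∸ i)) (suc n)
invRev≡applyUpTo c zero    = refl
invRev≡applyUpTo c (suc n) = cong (invPS c (suc n) ∷_) (invRev≡applyUpTo c n)

invPS-suc : ∀ (c : PS) n → invPS c (suc n) ≡ - (invℚ (c 0) * Σ< (suc n) (λ i → c (suc i) * invPS c (n ∸ i)))
invPS-suc c n = cong (λ z → - (invℚ (c 0) * z)) (begin
  sumList (zipWith _*_ (List.map (λ i → c (suc i)) (upTo (suc n))) (invRev c n))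
    ≡⟨ cong₂ (λ u v → sumList (zipWith _*_ u v)) (List.map-applyUpTo (λ i → i) (λ i → c (suc i)) (suc n)) (invRev≡applyUpTo c n) ⟩
  sumList (zipWith _*_ (applyUpTo (λ i → c (suc i)) (suc n)) (applyUpTo (λ i → invPS c (n ∸ i)) (suc n)))
    ≡⟨ sumList-zipWith-* (λ i → c (suc i)) (λ i → invPS c (n ∸ i)) (suc n) ⟩
  Σ< (suc n) (λ i → c (suc i) * invPS c (n ∸ i))
    ∎)
  where open ≡-Reasoning

invPS-inverseʳ : ∀ (c : PS) → c 0 ≢ 0ℚ → c ⊛ invPS c ≗ 1ₚ
invPS-inverseʳ c c₀≢0 zero    = trans (+-identityˡ _) (*-invℚʳ (c 0) c₀≢0)
invPS-inverseʳ c c₀≢0 (suc n) = begin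
  (c ⊛ invPS c) (suc n)                   ≡⟨ Σ<-head (suc n) (λ i → c i * invPS c (suc n ∸ i)) ⟩
  c 0 * invPS c (suc n) + X               ≡⟨ cong (λ z → c 0 * z + X) (invPS-suc c n) ⟩
  c 0 * (- (invℚ (c 0) * X)) + X          ≡⟨ solve 3 (λ a b x → a :* (:- (b :* x)) :+ x := (con 1ℚ :- a :* b) :* x) refl (c 0) (invℚ (c 0)) X ⟩
  (1ℚ - c 0 * invℚ (c 0)) * X             ≡⟨ cong (λ z → (1ℚ - z) * X) (*-invℚʳ (c 0) c₀≢0) ⟩
  (1ℚ - 1ℚ) * X                           ≡⟨ solve 1 (λ x → (con 1ℚ :- con 1ℚ) :* x := con 0ℚ) refl X ⟩
  0ℚ                                      ∎
  where
  open ≡-Reasoning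
  X = Σ< (suc n) (λ i → c (suc i) * invPS c (n ∸ i))

^ₚ-vanish : ∀ (h : PS) → h 0 ≡ 0ℚ → ∀ m i → i < m → (h ^ₚ m) i ≡ 0ℚ
^ₚ-vanish h h₀≡0 (suc m) i i≤m = begin
  (h ⊛ (h ^ₚ m)) i
    ≡⟨ Σ<-head i (λ j → h j * (h ^ₚ m) (i ∸ j)) ⟩
  h 0 * (h ^ₚ m) i + Σ< i (λ j → h (suc j) * (h ^ₚ m) (i ∸ suc j))
    ≡⟨ cong₂ _+_ (trans (cong (_* (h ^ₚ m) i) h₀≡0) (*-zeroˡ ((h ^ₚ m) i)))
                 (Σ<-zero i _ (λ j j<i → trans (cong (h (suc j) *_) (vanish j j<i)) (*-zeroʳ (h (suc j))))) ⟩
  0ℚ + 0ℚ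
    ∎
  where
  open ≡-Reasoning
  vanish : ∀ j → j < i → (h ^ₚ m) (i ∸ suc j) ≡ 0ℚ
  vanish j j<i = ^ₚ-vanish h h₀≡0 m (i ∸ suc j) (ℕ.<-≤-trans (ℕ.∸-monoʳ-< ℕ.z<s j<i) (ℕ.≤-pred i≤m))

∘ₚ-⊛ : ∀ (f g h : PS) → h 0 ≡ 0ℚ → ∀ n → ((f ∘ₚ h) ⊛ g) n ≡ Σ< (suc n) (λ m → f m * ((h ^ₚ m) ⊛ g) n)
∘ₚ-⊛ f g h h₀≡0 n = begin
  Σ< (suc n) (λ i → Σ< (suc i) (λ m → f m * (h ^ₚ m) i) * g (n ∸ i))
    ≡⟨ Σ<-cong (suc n) (λ i i≤n → cong (_* g (n ∸ i)) (Σ<-extend (suc i) (suc n) _ i≤n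
                         (λ m i<m → trans (cong (f m *_) (^ₚ-vanish h h₀≡0 m i i<m)) (*-zeroʳ (f m))))) ⟨
  Σ< (suc n) (λ i → Σ< (suc n) (λ m → f m * (h ^ₚ m) i) * g (n ∸ i))
    ≡⟨ Σ<-cong′ (suc n) (λ i → trans (sym (Σ<-*ʳ (suc n) (g (n ∸ i)) _)) (Σ<-cong′ (suc n) (λ m → *-assoc (f m) _ _))) ⟩
  Σ< (suc n) (λ i → Σ< (suc n) (λ m → f m * ((h ^ₚ m) i * g (n ∸ i))))
    ≡⟨ Σ<-comm (suc n) (suc n) _ ⟩
  Σ< (suc n) (λ m → Σ< (suc n) (λ i → f m * ((h ^ₚ m) i * g (n ∸ i))))
    ≡⟨ Σ<-cong′ (suc n) (λ m → Σ<-*ˡ (suc n) (f m) _) ⟩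
  Σ< (suc n) (λ m → f m * ((h ^ₚ m) ⊛ g) n)
    ∎
  where open ≡-Reasoning

β : PS
β = invPS expm1/t

expm1/t⊛β≗1ₚ : expm1/t ⊛ β ≗ 1ₚ
expm1/t⊛β≗1ₚ = invPS-inverseʳ expm1/t (λ ())

θ-expm1/t : ∀ n → θ expm1/t n ≡ 1ℚ * 1ₚ n + 1ℚ * shift expm1/t n + (- 1ℚ) * expm1/t n
θ-expm1/t zero    = refl
θ-expm1/t (suc m) = begin
  N * I                                   ≡⟨ solve 2 (λ n i → n :* i := (con 1ℚ :+ n) :* i :- i) refl N I ⟩
  (1ℚ + N) * I - I                        ≡⟨ cong (λ z → z * I - I) (ℕtoℚ-suc (suc m)) ⟨
  ℕtoℚ (suc (suc m)) * I - I              ≡⟨ cong (_- I) ([1+m]*invℚ[1+m]!≡invℚm! (suc m)) ⟩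
  invℚ (ℕtoℚ (suc m !)) - I               ≡⟨ solve 2 (λ a i → a :- i := con 1ℚ :* con 0ℚ :+ con 1ℚ :* a :+ con (- 1ℚ) :* i)
                                               refl (invℚ (ℕtoℚ (suc m !))) I ⟩
  1ℚ * 0ℚ + 1ℚ * invℚ (ℕtoℚ (suc m !)) + (- 1ℚ) * I ∎
  where
  open ≡-Reasoning
  N = ℕtoℚ (suc m)
  I = expm1/t (suc m)

-- Differentiating  E β = 1  gives  t β′ = β − t β − β².
θ-β : ∀ n → θ β n ≡ 1ℚ * β n + (- 1ℚ) * shift β n + (- 1ℚ) * (β ⊛ β) n
θ-β n = begin
  θ β n                     ≡⟨ ⊛-identityˡ (θ β) n ⟨
  (1ₚ ⊛ θ β) n              ≡⟨ ⊛-congˡ (θ β) (λ i → trans (⊛-comm β E i) (expm1/t⊛β≗1ₚ i)) n ⟨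
  ((β ⊛ E) ⊛ θ β) n         ≡⟨ ⊛-assoc β E (θ β) n ⟩
  (β ⊛ (E ⊛ θ β)) n         ≡⟨ ⊛-congʳ β E⊛θβ n ⟩
  (β ⊛ (λ i → (- 1ℚ) * β i + (- 1ℚ) * shift 1ₚ i + 1ℚ * 1ₚ i)) n
                            ≡⟨ ⊛-linear₃ʳ (- 1ℚ) (- 1ℚ) 1ℚ β (shift 1ₚ) 1ₚ β n ⟩
  (- 1ℚ) * (β ⊛ β) n + (- 1ℚ) * (β ⊛ shift 1ₚ) n + 1ℚ * (β ⊛ 1ₚ) n
                            ≡⟨ cong₂ (λ u v → (- 1ℚ) * (β ⊛ β) n + (- 1ℚ) * u + 1ℚ * v)
                                     (trans (shift-⊛ʳ β 1ₚ n) (shift-cong (⊛-identityʳ β) n)) (⊛-identityʳ β n) ⟩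
  (- 1ℚ) * (β ⊛ β) n + (- 1ℚ) * shift β n + 1ℚ * β n
                            ≡⟨ solve 3 (λ a b c → con (- 1ℚ) :* a :+ con (- 1ℚ) :* b :+ con 1ℚ :* c
                                                  := con 1ℚ :* c :+ con (- 1ℚ) :* b :+ con (- 1ℚ) :* a) refl ((β ⊛ β) n) (shift β n) (β n) ⟩
  1ℚ * β n + (- 1ℚ) * shift β n + (- 1ℚ) * (β ⊛ β) n ∎
  where
  open ≡-Reasoning
  E = expm1/t

  θE⊛β : ∀ n → (θ E ⊛ β) n ≡ 1ℚ * β n + 1ℚ * shift 1ₚ n + (- 1ℚ) * 1ₚ n
  θE⊛β n = begin
    (θ E ⊛ β) n ≡⟨ ⊛-congˡ β θ-expm1/t n ⟩
    ((λ i → 1ℚ * 1ₚ i + 1ℚ * shift E i + (- 1ℚ) * E i) ⊛ β) n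
                ≡⟨ ⊛-linear₃ˡ 1ℚ 1ℚ (- 1ℚ) 1ₚ (shift E) E β n ⟩
    1ℚ * (1ₚ ⊛ β) n + 1ℚ * (shift E ⊛ β) n + (- 1ℚ) * (E ⊛ β) n
                ≡⟨ cong₂ (λ u v → 1ℚ * u + 1ℚ * v + (- 1ℚ) * (E ⊛ β) n)
                         (⊛-identityˡ β n) (trans (shift-⊛ˡ E β n) (shift-cong expm1/t⊛β≗1ₚ n)) ⟩
    1ℚ * β n + 1ℚ * shift 1ₚ n + (- 1ℚ) * (E ⊛ β) n
                ≡⟨ cong (λ w → 1ℚ * β n + 1ℚ * shift 1ₚ n + (- 1ℚ) * w) (expm1/t⊛β≗1ₚ n) ⟩
    1ℚ * β n + 1ℚ * shift 1ₚ n + (- 1ℚ) * 1ₚ n ∎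

  E⊛θβ : ∀ n → (E ⊛ θ β) n ≡ (- 1ℚ) * β n + (- 1ℚ) * shift 1ₚ n + 1ℚ * 1ₚ n
  E⊛θβ n = begin
    (E ⊛ θ β) n                               ≡⟨ solve 2 (λ x y → y := (x :+ y) :- x) refl ((θ E ⊛ β) n) _ ⟩
    ((θ E ⊛ β) n + (E ⊛ θ β) n) - (θ E ⊛ β) n ≡⟨ cong₂ _-_ (sym (θ-Leibniz E β n)) (θE⊛β n) ⟩
    θ (E ⊛ β) n - (1ℚ * β n + 1ℚ * shift 1ₚ n + (- 1ℚ) * 1ₚ n)
                                              ≡⟨ cong (λ z → z - (1ℚ * β n + 1ℚ * shift 1ₚ n + (- 1ℚ) * 1ₚ n))
                                                      (trans (cong (ℕtoℚ n *_) (expm1/t⊛β≗1ₚ n)) (θ-1ₚ n)) ⟩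
    0ℚ - (1ℚ * β n + 1ℚ * shift 1ₚ n + (- 1ℚ) * 1ₚ n)
                                              ≡⟨ solve 3 (λ a b c → con 0ℚ :- (con 1ℚ :* a :+ con 1ℚ :* b :+ con (- 1ℚ) :* c)
                                                                    := con (- 1ℚ) :* a :+ con (- 1ℚ) :* b :+ con 1ℚ :* c)
                                                   refl (β n) (shift 1ₚ n) (1ₚ n) ⟩
    (- 1ℚ) * β n + (- 1ℚ) * shift 1ₚ n + 1ℚ * 1ₚ n ∎

θ-β^ : ∀ m l → θ (β ^ₚ m) l ≡ ℕtoℚ m * (β ^ₚ m) l + (- ℕtoℚ m) * shift (β ^ₚ m) l + (- ℕtoℚ m) * (β ^ₚ suc m) l
θ-β^ zero l = trans (trans (cong (ℕtoℚ l *_) (^ₚ-zero β l)) (θ-1ₚ l))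
  (solve 3 (λ x y z → con 0ℚ := con 0ℚ :* x :+ (:- con 0ℚ) :* y :+ (:- con 0ℚ) :* z) refl (P l) (shift P l) ((β ^ₚ 1) l))
  where P = β ^ₚ 0
θ-β^ (suc m) l = begin
  θ (β ⊛ P) l
    ≡⟨ θ-Leibniz β P l ⟩
  (θ β ⊛ P) l + (β ⊛ θ P) l
    ≡⟨ cong₂ _+_ (⊛-congˡ P θ-β l) (⊛-congʳ β (θ-β^ m) l) ⟩
  ((λ i → 1ℚ * β i + (- 1ℚ) * shift β i + (- 1ℚ) * (β ⊛ β) i) ⊛ P) l + (β ⊛ (λ i → M * P i + (- M) * shift P i + (- M) * P₁ i)) l
    ≡⟨ cong₂ _+_ (⊛-linear₃ˡ 1ℚ (- 1ℚ) (- 1ℚ) β (shift β) (β ⊛ β) P l) (⊛-linear₃ʳ M (- M) (- M) P (shift P) P₁ β l) ⟩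
  (1ℚ * P₁ l + (- 1ℚ) * (shift β ⊛ P) l + (- 1ℚ) * ((β ⊛ β) ⊛ P) l) + (M * P₁ l + (- M) * (β ⊛ shift P) l + (- M) * (β ⊛ P₁) l)
    ≡⟨ cong₂ (λ u v → (1ℚ * P₁ l + (- 1ℚ) * u + (- 1ℚ) * ((β ⊛ β) ⊛ P) l) + (M * P₁ l + (- M) * v + (- M) * P₂ l))
             (shift-⊛ˡ β P l) (shift-⊛ʳ β P l) ⟩
  (1ℚ * P₁ l + (- 1ℚ) * shift P₁ l + (- 1ℚ) * ((β ⊛ β) ⊛ P) l) + (M * P₁ l + (- M) * shift P₁ l + (- M) * P₂ l)
    ≡⟨ cong (λ u → (1ℚ * P₁ l + (- 1ℚ) * shift P₁ l + (- 1ℚ) * u) + (M * P₁ l + (- M) * shift P₁ l + (- M) * P₂ l))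
            (⊛-assoc β β P l) ⟩
  (1ℚ * P₁ l + (- 1ℚ) * shift P₁ l + (- 1ℚ) * P₂ l) + (M * P₁ l + (- M) * shift P₁ l + (- M) * P₂ l)
    ≡⟨ solve 4 (λ m a b c → (con 1ℚ :* a :+ con (- 1ℚ) :* b :+ con (- 1ℚ) :* c) :+ (m :* a :+ (:- m) :* b :+ (:- m) :* c)
                            := (con 1ℚ :+ m) :* a :+ (:- (con 1ℚ :+ m)) :* b :+ (:- (con 1ℚ :+ m)) :* c)
               refl M (P₁ l) (shift P₁ l) (P₂ l) ⟩
  (1ℚ + M) * P₁ l + (- (1ℚ + M)) * shift P₁ l + (- (1ℚ + M)) * P₂ l
    ≡⟨ cong (λ z → z * P₁ l + (- z) * shift P₁ l + (- z) * P₂ l) (ℕtoℚ-suc m) ⟨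
  ℕtoℚ (suc m) * P₁ l + (- ℕtoℚ (suc m)) * shift P₁ l + (- ℕtoℚ (suc m)) * P₂ l
    ∎
  where
  open ≡-Reasoning
  P  = β ^ₚ m
  P₁ = β ^ₚ suc m
  P₂ = β ^ₚ suc (suc m)
  M  = ℕtoℚ m

-- Signed Stirling numbers of the first kind:  t (t − 1) ⋯ (t − n + 1) = Σ_M stirling n M tᴹ.
stirling : ℕ → ℕ → ℚ
stirling zero    zero    = 1ℚ
stirling zero    (suc M) = 0ℚ
stirling (suc n) zero    = 0ℚ
stirling (suc n) (suc M) = stirling n M - ℕtoℚ n * stirling n (suc M)

stirling-vanish : ∀ {n M} → n < M → stirling n M ≡ 0ℚ
stirling-vanish {zero}  {suc M} _ = refl
stirling-vanish {suc n} {suc M} (ℕ.s≤s n<M) =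
  trans (cong₂ (λ u v → u - ℕtoℚ n * v) (stirling-vanish n<M) (stirling-vanish (ℕ.m<n⇒m<1+n n<M)))
        (solve 1 (λ x → con 0ℚ :- x :* con 0ℚ := con 0ℚ) refl (ℕtoℚ n))

n*stirling[n,0]≡0 : ∀ n → ℕtoℚ n * stirling n 0 ≡ 0ℚ
n*stirling[n,0]≡0 zero    = refl
n*stirling[n,0]≡0 (suc n) = *-zeroʳ (ℕtoℚ (suc n))

!*β^-recurrence : ∀ p l →
  ℕtoℚ (suc p !) * (β ^ₚ suc (suc p)) l
    ≡ (ℕtoℚ (suc p) - ℕtoℚ l) * (ℕtoℚ (p !) * (β ^ₚ suc p) l) - ℕtoℚ (suc p) * (ℕtoℚ (p !) * shift (β ^ₚ suc p) l)
!*β^-recurrence p l = begin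
  ℕtoℚ (suc p ℕ.* p !) * Z          ≡⟨ cong (_* Z) (ℕtoℚ-homo-* (suc p) (p !)) ⟩
  N * A * Z                         ≡⟨ solve 6 (λ n a l x y z → n :* a :* z := (n :- l) :* (a :* x) :- n :* (a :* y)
                                                               :+ a :* (l :* x :- (n :* x :+ (:- n) :* y :+ (:- n) :* z)))
                                             refl N A L X Y Z ⟩
  (N - L) * (A * X) - N * (A * Y) + A * (L * X - R)
                                    ≡⟨ cong (λ z → (N - L) * (A * X) - N * (A * Y) + A * (z - R)) (θ-β^ (suc p) l) ⟩
  (N - L) * (A * X) - N * (A * Y) + A * (R - R)
                                    ≡⟨ solve 4 (λ u v a r → u :- v :+ a :* (r :- r) := u :- v) refl ((N - L) * (A * X)) (N * (A * Y)) A R ⟩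
  (N - L) * (A * X) - N * (A * Y)   ∎
  where
  open ≡-Reasoning
  N = ℕtoℚ (suc p)
  A = ℕtoℚ (p !)
  L = ℕtoℚ l
  X = (β ^ₚ suc p) l
  Y = shift (β ^ₚ suc p) l
  Z = (β ^ₚ suc (suc p)) l
  R = N * X + (- N) * Y + (- N) * Z

!*β^≡!*stirling : ∀ p l q → l ℕ.+ q ≡ p → ℕtoℚ (p !) * (β ^ₚ suc p) l ≡ ℕtoℚ (q !) * stirling (suc p) (suc q)
!*β^≡!*stirling zero    zero     zero    refl = refl
!*β^≡!*stirling (suc p) zero     .(suc p) refl = begin
  ℕtoℚ (suc p !) * (β ^ₚ suc (suc p)) 0
    ≡⟨ !*β^-recurrence p 0 ⟩
  (N - 0ℚ) * (A * (β ^ₚ suc p) 0) - N * (A * 0ℚ)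
    ≡⟨ cong (λ z → (N - 0ℚ) * z - N * (A * 0ℚ)) (!*β^≡!*stirling p 0 p refl) ⟩
  (N - 0ℚ) * (A * S) - N * (A * 0ℚ)
    ≡⟨ solve 3 (λ n a s → (n :- con 0ℚ) :* (a :* s) :- n :* (a :* con 0ℚ) := (n :* a) :* (s :- n :* con 0ℚ)) refl N A S ⟩
  (N * A) * (S - N * 0ℚ)
    ≡⟨ cong₂ (λ u v → u * (S - N * v)) (ℕtoℚ-homo-* (suc p) (p !)) (stirling-vanish (ℕ.n<1+n (suc p))) ⟨
  ℕtoℚ (suc p !) * stirling (suc (suc p)) (suc (suc p))
    ∎
  where
  open ≡-Reasoning
  N = ℕtoℚ (suc p)
  A = ℕtoℚ (p !)
  S = stirling (suc p) (suc p)
!*β^≡!*stirling (suc p) (suc l) zero e with trans (sym (ℕ.+-identityʳ l)) (ℕ.suc-injective e)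
... | refl = begin
  ℕtoℚ (suc p !) * (β ^ₚ suc (suc p)) (suc p)
    ≡⟨ !*β^-recurrence p (suc p) ⟩
  (N - N) * (A * (β ^ₚ suc p) (suc p)) - N * (A * (β ^ₚ suc p) p)
    ≡⟨ cong (λ z → (N - N) * (A * (β ^ₚ suc p) (suc p)) - N * z) (!*β^≡!*stirling p p 0 (ℕ.+-identityʳ p)) ⟩
  (N - N) * (A * (β ^ₚ suc p) (suc p)) - N * (1ℚ * S)
    ≡⟨ solve 4 (λ n a x s → (n :- n) :* (a :* x) :- n :* (con 1ℚ :* s) := con 1ℚ :* (con 0ℚ :- n :* s)) refl N A ((β ^ₚ suc p) (suc p)) S ⟩
  1ℚ * (0ℚ - N * S)
    ∎
  where
  open ≡-Reasoning
  N = ℕtoℚ (suc p)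
  A = ℕtoℚ (p !)
  S = stirling (suc p) 1
!*β^≡!*stirling (suc p) (suc l) (suc q) e = begin
  ℕtoℚ (suc p !) * (β ^ₚ suc (suc p)) (suc l)
    ≡⟨ !*β^-recurrence p (suc l) ⟩
  (N - L) * (A * (β ^ₚ suc p) (suc l)) - N * (A * (β ^ₚ suc p) l)
    ≡⟨ cong₂ (λ u v → (N - L) * u - N * v) (!*β^≡!*stirling p (suc l) q e₁) (!*β^≡!*stirling p l (suc q) e₂) ⟩
  (N - L) * (F * S₁) - N * (ℕtoℚ (suc q ℕ.* q !) * S₂)
    ≡⟨ cong₂ (λ u v → u * (F * S₁) - N * (v * S₂)) N-L≡Q (ℕtoℚ-homo-* (suc q) (q !)) ⟩
  Q * (F * S₁) - N * ((Q * F) * S₂)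
    ≡⟨ solve 5 (λ q f n s t → q :* (f :* s) :- n :* ((q :* f) :* t) := (q :* f) :* (s :- n :* t)) refl Q F N S₁ S₂ ⟩
  (Q * F) * (S₁ - N * S₂)
    ≡⟨ cong (_* (S₁ - N * S₂)) (ℕtoℚ-homo-* (suc q) (q !)) ⟨
  ℕtoℚ (suc q !) * stirling (suc (suc p)) (suc (suc q))
    ∎
  where
  open ≡-Reasoning
  N = ℕtoℚ (suc p)
  A = ℕtoℚ (p !)
  L = ℕtoℚ (suc l)
  Q = ℕtoℚ (suc q)
  F = ℕtoℚ (q !)
  S₁ = stirling (suc p) (suc q)
  S₂ = stirling (suc p) (suc (suc q))
  e₂ : l ℕ.+ suc q ≡ p
  e₂ = ℕ.suc-injective e
  e₁ : suc l ℕ.+ q ≡ p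
  e₁ = trans (sym (ℕ.+-suc l q)) e₂
  N-L≡Q : N - L ≡ Q
  N-L≡Q = begin
    N - L                       ≡⟨ cong (λ z → ℕtoℚ z - L) e ⟨
    ℕtoℚ (suc l ℕ.+ suc q) - L  ≡⟨ cong (_- L) (ℕtoℚ-homo-+ (suc l) (suc q)) ⟩
    L + Q - L                   ≡⟨ solve 2 (λ l q → l :+ q :- l := q) refl L Q ⟩
    Q                           ∎

[1+t]θ-^ₚ-zero : ∀ g n → [1+t]θ (g ^ₚ 0) n ≡ 0ℚ
[1+t]θ-^ₚ-zero g zero    = refl
[1+t]θ-^ₚ-zero g (suc n) = cong₂ _+_ (θ-1ₚ (suc n)) (trans (cong (ℕtoℚ n *_) (^ₚ-zero g n)) (θ-1ₚ n))

θ-log1+t-suc : ∀ k → θ log1+t (suc k) ≡ sign k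
θ-log1+t-suc k = begin
  N * (sign k * invℚ N)   ≡⟨ solve 3 (λ n s i → n :* (s :* i) := s :* (n :* i)) refl N (sign k) (invℚ N) ⟩
  sign k * (N * invℚ N)   ≡⟨ cong (sign k *_) (*-invℚʳ N (ℕtoℚ-suc≢0 k)) ⟩
  sign k * 1ℚ             ≡⟨ *-identityʳ (sign k) ⟩
  sign k                  ∎
  where
  open ≡-Reasoning
  N = ℕtoℚ (suc k)

[1+t]θ-log1+t : [1+t]θ log1+t ≗ shift 1ₚ
[1+t]θ-log1+t zero          = refl
[1+t]θ-log1+t (suc zero)    = refl
[1+t]θ-log1+t (suc (suc m)) = trans (cong₂ _+_ (θ-log1+t-suc (suc m)) (θ-log1+t-suc m))
                                    (solve 1 (λ s → con (- 1ℚ) :* s :+ s := con 0ℚ) refl (sign m))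

[1+t]θ-log1+t^ : ∀ m n → [1+t]θ (log1+t ^ₚ suc m) n ≡ ℕtoℚ (suc m) * shift (log1+t ^ₚ m) n
[1+t]θ-log1+t^ m n = begin
  [1+t]θ (L ⊛ (L ^ₚ m)) n
    ≡⟨ [1+t]θ-Leibniz L (L ^ₚ m) n ⟩
  ([1+t]θ L ⊛ (L ^ₚ m)) n + (L ⊛ [1+t]θ (L ^ₚ m)) n
    ≡⟨ cong₂ _+_ (trans (⊛-congˡ (L ^ₚ m) [1+t]θ-log1+t n)
                        (trans (shift-⊛ˡ 1ₚ (L ^ₚ m) n) (shift-cong (⊛-identityˡ (L ^ₚ m)) n)))
                 (L⊛[1+t]θL^ m) ⟩
  shift (L ^ₚ m) n + ℕtoℚ m * shift (L ^ₚ m) n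
    ≡⟨ solve 2 (λ s a → s :+ a :* s := (con 1ℚ :+ a) :* s) refl (shift (L ^ₚ m) n) (ℕtoℚ m) ⟩
  (1ℚ + ℕtoℚ m) * shift (L ^ₚ m) n
    ≡⟨ cong (_* shift (L ^ₚ m) n) (ℕtoℚ-suc m) ⟨
  ℕtoℚ (suc m) * shift (L ^ₚ m) n
    ∎
  where
  open ≡-Reasoning
  L = log1+t
  L⊛[1+t]θL^ : ∀ m → (L ⊛ [1+t]θ (L ^ₚ m)) n ≡ ℕtoℚ m * shift (L ^ₚ m) n
  L⊛[1+t]θL^ zero    = trans (⊛-congʳ L ([1+t]θ-^ₚ-zero L) n) (trans (⊛-zeroʳ L n) (sym (*-zeroˡ (shift (L ^ₚ 0) n))))
  L⊛[1+t]θL^ (suc m) = trans (⊛-congʳ L ([1+t]θ-log1+t^ m) n)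
                             (trans (⊛-*ʳ (ℕtoℚ (suc m)) L (shift (L ^ₚ m)) n) (cong (ℕtoℚ (suc m) *_) (shift-⊛ʳ L (L ^ₚ m) n)))

[1+t]θ-suc⇒!-scaled : ∀ c (G : PS) n R → [1+t]θ G (suc n) ≡ R →
                      ℕtoℚ (suc n !) * c * G (suc n) ≡ ℕtoℚ (n !) * c * (R - ℕtoℚ n * G n)
[1+t]θ-suc⇒!-scaled c G n R eq = begin
  ℕtoℚ (suc n ℕ.* n !) * c * G (suc n)
    ≡⟨ cong (λ z → z * c * G (suc n)) (ℕtoℚ-homo-* (suc n) (n !)) ⟩
  (ℕtoℚ (suc n) * ℕtoℚ (n !)) * c * G (suc n)
    ≡⟨ solve 5 (λ a f c g d → (a :* f) :* c :* g := f :* c :* ((a :* g :+ d) :- d)) refl (ℕtoℚ (suc n)) (ℕtoℚ (n !)) c (G (suc n)) (ℕtoℚ n * G n) ⟩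
  ℕtoℚ (n !) * c * ([1+t]θ G (suc n) - ℕtoℚ n * G n)
    ≡⟨ cong (λ z → ℕtoℚ (n !) * c * (z - ℕtoℚ n * G n)) eq ⟩
  ℕtoℚ (n !) * c * (R - ℕtoℚ n * G n)
    ∎
  where open ≡-Reasoning

module _ (x : ℚ) where

  private
    b : PS
    b = binomPS (- x)

  [1+t]θ-binom : ∀ n → [1+t]θ b n ≡ (- x) * shift b n
  [1+t]θ-binom zero    = solve 2 (λ u x → con 0ℚ :* u :+ con 0ℚ := (:- x) :* con 0ℚ) refl (b 0) x
  [1+t]θ-binom (suc m) = begin
    N * ((fm * (- x + - M)) * invℚ (ℕtoℚ (suc m !))) + M * (fm * I)
      ≡⟨ cong (_+ M * (fm * I)) (solve 4 (λ a u w i → a :* ((u :* w) :* i) := (u :* w) :* (a :* i)) refl N fm (- x + - M) (invℚ (ℕtoℚ (suc m !)))) ⟩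
    (fm * (- x + - M)) * (N * invℚ (ℕtoℚ (suc m !))) + M * (fm * I)
      ≡⟨ cong (λ z → (fm * (- x + - M)) * z + M * (fm * I)) ([1+m]*invℚ[1+m]!≡invℚm! m) ⟩
    (fm * (- x + - M)) * I + M * (fm * I)
      ≡⟨ solve 4 (λ u x y i → (u :* (:- x :+ :- y)) :* i :+ y :* (u :* i) := (:- x) :* (u :* i)) refl fm x M I ⟩
    (- x) * (fm * I)
      ∎
    where
    open ≡-Reasoning
    N  = ℕtoℚ (suc m)
    M  = ℕtoℚ m
    fm = fallingℚ (- x) m
    I  = invℚ (ℕtoℚ (m !))

  Λ : ℕ → PS
  Λ m = (log1+t ^ₚ m) ⊛ b

  [1+t]θ-Λ-zero : ∀ n → [1+t]θ (Λ 0) n ≡ (- x) * shift (Λ 0) n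
  [1+t]θ-Λ-zero n = begin
    [1+t]θ (Λ 0) n
      ≡⟨ [1+t]θ-Leibniz (log1+t ^ₚ 0) b n ⟩
    ([1+t]θ (log1+t ^ₚ 0) ⊛ b) n + ((log1+t ^ₚ 0) ⊛ [1+t]θ b) n
      ≡⟨ cong₂ _+_ (trans (⊛-congˡ b ([1+t]θ-^ₚ-zero log1+t) n) (trans (⊛-comm (λ _ → 0ℚ) b n) (⊛-zeroʳ b n)))
                   (trans (⊛-congʳ (log1+t ^ₚ 0) [1+t]θ-binom n)
                          (trans (⊛-*ʳ (- x) (log1+t ^ₚ 0) (shift b) n) (cong ((- x) *_) (shift-⊛ʳ (log1+t ^ₚ 0) b n)))) ⟩
    0ℚ + (- x) * shift (Λ 0) n
      ≡⟨ +-identityˡ _ ⟩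
    (- x) * shift (Λ 0) n
      ∎
    where open ≡-Reasoning

  [1+t]θ-Λ-suc : ∀ m n → [1+t]θ (Λ (suc m)) n ≡ ℕtoℚ (suc m) * shift (Λ m) n + (- x) * shift (Λ (suc m)) n
  [1+t]θ-Λ-suc m n = begin
    [1+t]θ (Λ (suc m)) n
      ≡⟨ [1+t]θ-Leibniz (log1+t ^ₚ suc m) b n ⟩
    ([1+t]θ (log1+t ^ₚ suc m) ⊛ b) n + ((log1+t ^ₚ suc m) ⊛ [1+t]θ b) n
      ≡⟨ cong₂ _+_ (trans (⊛-congˡ b ([1+t]θ-log1+t^ m) n)
                          (trans (⊛-*ˡ (ℕtoℚ (suc m)) (shift (log1+t ^ₚ m)) b n) (cong (ℕtoℚ (suc m) *_) (shift-⊛ˡ (log1+t ^ₚ m) b n))))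
                   (trans (⊛-congʳ (log1+t ^ₚ suc m) [1+t]θ-binom n)
                          (trans (⊛-*ʳ (- x) (log1+t ^ₚ suc m) (shift b) n) (cong ((- x) *_) (shift-⊛ʳ (log1+t ^ₚ suc m) b n)))) ⟩
    ℕtoℚ (suc m) * shift (Λ m) n + (- x) * shift (Λ (suc m)) n
      ∎
    where open ≡-Reasoning

  cauchyBasis : ℕ → ℕ → ℚ
  cauchyBasis m n = ℕtoℚ (n !) * invℚ (ℕtoℚ (m !)) * Λ m n

  cauchyBasis-zero-suc : ∀ n → cauchyBasis 0 (suc n) ≡ - (x + ℕtoℚ n) * cauchyBasis 0 n
  cauchyBasis-zero-suc n = trans ([1+t]θ-suc⇒!-scaled (invℚ 1ℚ) (Λ 0) n _ ([1+t]θ-Λ-zero (suc n)))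
    (solve 5 (λ a i x k g → a :* i :* ((:- x) :* g :- k :* g) := :- (x :+ k) :* (a :* i :* g)) refl (ℕtoℚ (n !)) (invℚ 1ℚ) x (ℕtoℚ n) (Λ 0 n))

  cauchyBasis-suc-suc : ∀ m n → cauchyBasis (suc m) (suc n) ≡ cauchyBasis m n - (x + ℕtoℚ n) * cauchyBasis (suc m) n
  cauchyBasis-suc-suc m n = begin
    cauchyBasis (suc m) (suc n)
      ≡⟨ [1+t]θ-suc⇒!-scaled I₁ (Λ (suc m)) n _ ([1+t]θ-Λ-suc m (suc n)) ⟩
    A * I₁ * (M₁ * Λ m n + (- x) * Λ (suc m) n - ℕtoℚ n * Λ (suc m) n)
      ≡⟨ solve 7 (λ a i m₁ u x k v → a :* i :* (m₁ :* u :+ (:- x) :* v :- k :* v) := a :* (m₁ :* i) :* u :- (x :+ k) :* (a :* i :* v))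
                 refl A I₁ M₁ (Λ m n) x (ℕtoℚ n) (Λ (suc m) n) ⟩
    A * (M₁ * I₁) * Λ m n - (x + ℕtoℚ n) * cauchyBasis (suc m) n
      ≡⟨ cong (λ z → A * z * Λ m n - (x + ℕtoℚ n) * cauchyBasis (suc m) n) ([1+m]*invℚ[1+m]!≡invℚm! m) ⟩
    cauchyBasis m n - (x + ℕtoℚ n) * cauchyBasis (suc m) n
      ∎
    where
    open ≡-Reasoning
    A  = ℕtoℚ (n !)
    I₁ = invℚ (ℕtoℚ (suc m !))
    M₁ = ℕtoℚ (suc m)

  cauchyBasis-vanish : ∀ {m n} → n < m → cauchyBasis m n ≡ 0ℚ
  cauchyBasis-vanish {suc m} {zero}  _ =
    trans (cong (λ z → 1ℚ * I * (0ℚ + z * b 0)) (^ₚ-vanish log1+t refl (suc m) 0 ℕ.z<s))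
          (solve 2 (λ i u → con 1ℚ :* i :* (con 0ℚ :+ con 0ℚ :* u) := con 0ℚ) refl I (b 0))
    where I = invℚ (ℕtoℚ (suc m !))
  cauchyBasis-vanish {suc m} {suc n} (ℕ.s≤s n<m) = begin
    cauchyBasis (suc m) (suc n)                         ≡⟨ cauchyBasis-suc-suc m n ⟩
    cauchyBasis m n - (x + ℕtoℚ n) * cauchyBasis (suc m) n    ≡⟨ cong₂ (λ u v → u - (x + ℕtoℚ n) * v) (cauchyBasis-vanish n<m) (cauchyBasis-vanish (ℕ.m<n⇒m<1+n n<m)) ⟩
    0ℚ - (x + ℕtoℚ n) * 0ℚ                       ≡⟨ solve 1 (λ y → con 0ℚ :- y :* con 0ℚ := con 0ℚ) refl (x + ℕtoℚ n) ⟩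
    0ℚ                                           ∎
    where open ≡-Reasoning

  cauchySum : (ℕ → ℚ) → ℕ → ℚ
  cauchySum c n = Σ< (suc n) (λ m → c m * cauchyBasis m n)

  cauchySum-suc : ∀ c n → cauchySum c (suc n) ≡ cauchySum (λ m → c (suc m)) n - (x + ℕtoℚ n) * cauchySum c n
  cauchySum-suc c n = begin
    cauchySum c (suc n)
      ≡⟨ Σ<-head (suc n) (λ m → c m * cauchyBasis m (suc n)) ⟩
    c 0 * cauchyBasis 0 (suc n) + Σ< (suc n) (λ m → c (suc m) * cauchyBasis (suc m) (suc n))
      ≡⟨ cong₂ _+_ (cong (c 0 *_) (cauchyBasis-zero-suc n)) (Σ<-cong′ (suc n) (λ m → cong (c (suc m) *_) (cauchyBasis-suc-suc m n))) ⟩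
    c 0 * (- y * cauchyBasis 0 n) + Σ< (suc n) (λ m → c (suc m) * (cauchyBasis m n - y * cauchyBasis (suc m) n))
      ≡⟨ cong (c 0 * (- y * cauchyBasis 0 n) +_) (Σ<-cong′ (suc n) (λ m →
           solve 4 (λ c u y v → c :* (u :- y :* v) := c :* u :+ (:- y) :* (c :* v)) refl (c (suc m)) (cauchyBasis m n) y (cauchyBasis (suc m) n))) ⟩
    c 0 * (- y * cauchyBasis 0 n) + Σ< (suc n) (λ m → c (suc m) * cauchyBasis m n + (- y) * (c (suc m) * cauchyBasis (suc m) n))
      ≡⟨ cong (c 0 * (- y * cauchyBasis 0 n) +_) (trans (Σ<-distrib-+ (suc n) _ _) (cong (cauchySum (λ m → c (suc m)) n +_) (Σ<-*ˡ (suc n) (- y) _))) ⟩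
    c 0 * (- y * cauchyBasis 0 n) + (cauchySum (λ m → c (suc m)) n + (- y) * T)
      ≡⟨ solve 5 (λ c₀ y g p t → c₀ :* (:- y :* g) :+ (p :+ (:- y) :* t) := p :- y :* (c₀ :* g :+ t)) refl (c 0) y (cauchyBasis 0 n) (cauchySum (λ m → c (suc m)) n) T ⟩
    cauchySum (λ m → c (suc m)) n - y * (c 0 * cauchyBasis 0 n + T)
      ≡⟨ cong (λ z → cauchySum (λ m → c (suc m)) n - y * z)
              (Σ<-head-vanish n (λ m → c m * cauchyBasis m n) (trans (cong (c (suc n) *_) (cauchyBasis-vanish (ℕ.n<1+n n))) (*-zeroʳ (c (suc n))))) ⟩
    cauchySum (λ m → c (suc m)) n - y * cauchySum c n
      ∎
    where
    open ≡-Reasoning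
    y = x + ℕtoℚ n
    T = Σ< (suc n) (λ m → c (suc m) * cauchyBasis (suc m) n)

  binomialSum : (ℕ → ℚ) → ℕ → ℚ
  binomialSum c M = Σ< (suc M) (λ j → ℕtoℚ (M C j) * powℚ (- x) j * c (M ∸ j))

  binomialSum-suc : ∀ c M → binomialSum c (suc M) ≡ binomialSum (λ m → c (suc m)) M + (- x) * binomialSum c M
  binomialSum-suc c M = begin
    binomialSum c (suc M)
      ≡⟨ Σ<-head (suc M) (λ j → ℕtoℚ (suc M C j) * powℚ (- x) j * c (suc M ∸ j)) ⟩
    ℕtoℚ 1 * 1ℚ * c (suc M) + Σ< (suc M) (λ j → ℕtoℚ (suc M C suc j) * powℚ (- x) (suc j) * c (M ∸ j))
      ≡⟨ cong (ℕtoℚ 1 * 1ℚ * c (suc M) +_) (trans (Σ<-cong′ (suc M) pascal) (trans (Σ<-distrib-+ (suc M) _ _) (cong (_+ T₂) (Σ<-*ˡ (suc M) (- x) _)))) ⟩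
    ℕtoℚ 1 * 1ℚ * c (suc M) + ((- x) * binomialSum c M + T₂)
      ≡⟨ cong (λ z → ℕtoℚ 1 * 1ℚ * c (suc M) + ((- x) * binomialSum c M + z)) T₂≡T₃ ⟩
    ℕtoℚ 1 * 1ℚ * c (suc M) + ((- x) * binomialSum c M + T₃)
      ≡⟨ solve 3 (λ a e t → con 1ℚ :* con 1ℚ :* a :+ (e :+ t) := (con 1ℚ :* con 1ℚ :* a :+ t) :+ e) refl (c (suc M)) ((- x) * binomialSum c M) T₃ ⟩
    (ℕtoℚ 1 * 1ℚ * c (suc M) + T₃) + (- x) * binomialSum c M
      ≡⟨ cong (_+ (- x) * binomialSum c M) (Σ<-head M (λ j → ℕtoℚ (M C j) * powℚ (- x) j * c (suc (M ∸ j)))) ⟨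
    binomialSum (λ m → c (suc m)) M + (- x) * binomialSum c M
      ∎
    where
    open ≡-Reasoning
    T₂ = Σ< (suc M) (λ j → ℕtoℚ (M C suc j) * powℚ (- x) (suc j) * c (M ∸ j))
    T₃ = Σ< M (λ j → ℕtoℚ (M C suc j) * powℚ (- x) (suc j) * c (suc (M ∸ suc j)))
    pascal : ∀ j → ℕtoℚ (suc M C suc j) * powℚ (- x) (suc j) * c (M ∸ j)
                 ≡ (- x) * (ℕtoℚ (M C j) * powℚ (- x) j * c (M ∸ j)) + ℕtoℚ (M C suc j) * powℚ (- x) (suc j) * c (M ∸ j)
    pascal j = begin
      ℕtoℚ (suc M C suc j) * powℚ (- x) (suc j) * c (M ∸ j)
        ≡⟨ cong (λ z → ℕtoℚ z * powℚ (- x) (suc j) * c (M ∸ j)) (nCk+nC[k+1]≡[n+1]C[k+1] M j) ⟨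
      ℕtoℚ (M C j ℕ.+ M C suc j) * powℚ (- x) (suc j) * c (M ∸ j)
        ≡⟨ cong (λ z → z * powℚ (- x) (suc j) * c (M ∸ j)) (ℕtoℚ-homo-+ (M C j) (M C suc j)) ⟩
      (ℕtoℚ (M C j) + ℕtoℚ (M C suc j)) * ((- x) * powℚ (- x) j) * c (M ∸ j)
        ≡⟨ solve 5 (λ a b y w u → (a :+ b) :* (y :* w) :* u := y :* (a :* w :* u) :+ b :* (y :* w) :* u)
                   refl (ℕtoℚ (M C j)) (ℕtoℚ (M C suc j)) (- x) (powℚ (- x) j) (c (M ∸ j)) ⟩
      (- x) * (ℕtoℚ (M C j) * powℚ (- x) j * c (M ∸ j)) + ℕtoℚ (M C suc j) * powℚ (- x) (suc j) * c (M ∸ j)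
        ∎
    T₂≡T₃ : T₂ ≡ T₃
    T₂≡T₃ = begin
      T₂
        ≡⟨ cong (Σ< M (λ j → ℕtoℚ (M C suc j) * powℚ (- x) (suc j) * c (M ∸ j)) +_)
                (cong (λ z → ℕtoℚ z * powℚ (- x) (suc M) * c (M ∸ M)) (k>n⇒nCk≡0 (ℕ.n<1+n M))) ⟩
      Σ< M (λ j → ℕtoℚ (M C suc j) * powℚ (- x) (suc j) * c (M ∸ j)) + 0ℚ * powℚ (- x) (suc M) * c (M ∸ M)
        ≡⟨ solve 3 (λ s p u → s :+ con 0ℚ :* p :* u := s) refl _ (powℚ (- x) (suc M)) (c (M ∸ M)) ⟩
      Σ< M (λ j → ℕtoℚ (M C suc j) * powℚ (- x) (suc j) * c (M ∸ j))
        ≡⟨ Σ<-cong M (λ j j<M → cong (λ z → ℕtoℚ (M C suc j) * powℚ (- x) (suc j) * c z) (ℕ.+-∸-assoc 1 j<M)) ⟩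
      T₃
        ∎

  stirlingSum : (ℕ → ℚ) → ℕ → ℚ
  stirlingSum c n = Σ< (suc n) (λ M → stirling n M * binomialSum c M)

  stirlingSum-suc : ∀ c n → stirlingSum c (suc n) ≡ stirlingSum (λ m → c (suc m)) n - (x + ℕtoℚ n) * stirlingSum c n
  stirlingSum-suc c n = begin
    stirlingSum c (suc n)
      ≡⟨ Σ<-head (suc n) (λ M → stirling (suc n) M * E c M) ⟩
    0ℚ * E c 0 + Σ< (suc n) (λ M → (stirling n M - N * stirling n (suc M)) * E c (suc M))
      ≡⟨ cong₂ _+_ (*-zeroˡ (E c 0)) (Σ<-cong′ (suc n) expand) ⟩
    0ℚ + Σ< (suc n) (λ M → 1ℚ * (stirling n M * E c′ M) + (- x) * (stirling n M * E c M) + (- N) * (stirling n (suc M) * E c (suc M)))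
      ≡⟨ trans (+-identityˡ _) (Σ<-linear₃ (suc n) 1ℚ (- x) (- N) _ _ _) ⟩
    1ℚ * stirlingSum c′ n + (- x) * stirlingSum c n + (- N) * U
      ≡⟨ solve 7 (λ p q u k s e y → con 1ℚ :* p :+ (:- y) :* q :+ (:- k) :* u := p :- (y :+ k) :* q :+ k :* (q :- (s :* e :+ u)) :+ (k :* s) :* e)
                 refl (stirlingSum c′ n) (stirlingSum c n) U N (stirling n 0) (E c 0) x ⟩
    stirlingSum c′ n - (x + N) * stirlingSum c n + N * (stirlingSum c n - (stirling n 0 * E c 0 + U)) + (N * stirling n 0) * E c 0
      ≡⟨ cong₂ (λ u v → stirlingSum c′ n - (x + N) * stirlingSum c n + N * (stirlingSum c n - u) + v * E c 0)
               (Σ<-head-vanish n (λ M → stirling n M * E c M) (trans (cong (_* E c (suc n)) (stirling-vanish (ℕ.n<1+n n))) (*-zeroˡ (E c (suc n)))))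
               (n*stirling[n,0]≡0 n) ⟩
    stirlingSum c′ n - (x + N) * stirlingSum c n + N * (stirlingSum c n - stirlingSum c n) + 0ℚ * E c 0
      ≡⟨ solve 4 (λ a k q e → a :+ k :* (q :- q) :+ con 0ℚ :* e := a) refl (stirlingSum c′ n - (x + N) * stirlingSum c n) N (stirlingSum c n) (E c 0) ⟩
    stirlingSum c′ n - (x + N) * stirlingSum c n
      ∎
    where
    open ≡-Reasoning
    N = ℕtoℚ n
    E = binomialSum
    c′ = λ m → c (suc m)
    U = Σ< (suc n) (λ M → stirling n (suc M) * E c (suc M))
    expand : ∀ M → (stirling n M - N * stirling n (suc M)) * E c (suc M)
                 ≡ 1ℚ * (stirling n M * E c′ M) + (- x) * (stirling n M * E c M) + (- N) * (stirling n (suc M) * E c (suc M))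
    expand M = trans (cong ((stirling n M - N * stirling n (suc M)) *_) (binomialSum-suc c M))
      (trans (solve 6 (λ s t k a e y → (s :- k :* t) :* (a :+ (:- y) :* e) := con 1ℚ :* (s :* a) :+ (:- y) :* (s :* e) :+ (:- k) :* (t :* (a :+ (:- y) :* e)))
                   refl (stirling n M) (stirling n (suc M)) N (E c′ M) (E c M) x)
             (cong (λ z → 1ℚ * (stirling n M * E c′ M) + (- x) * (stirling n M * E c M) + (- N) * (stirling n (suc M) * z)) (sym (binomialSum-suc c M))))

  cauchySum≡stirlingSum : ∀ n c → cauchySum c n ≡ stirlingSum c n
  cauchySum≡stirlingSum zero    c = solve 1 (λ a → con 0ℚ :+ a :* con 1ℚ := con 0ℚ :+ con 1ℚ :* (con 0ℚ :+ con 1ℚ :* con 1ℚ :* a)) refl (c 0)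
  cauchySum≡stirlingSum (suc n) c = begin
    cauchySum c (suc n)                                                   ≡⟨ cauchySum-suc c n ⟩
    cauchySum (λ m → c (suc m)) n - (x + ℕtoℚ n) * cauchySum c n          ≡⟨ cong₂ (λ u v → u - (x + ℕtoℚ n) * v)
                                                                                  (cauchySum≡stirlingSum n (λ m → c (suc m))) (cauchySum≡stirlingSum n c) ⟩
    stirlingSum (λ m → c (suc m)) n - (x + ℕtoℚ n) * stirlingSum c n      ≡⟨ stirlingSum-suc c n ⟨
    stirlingSum c (suc n)                                                 ∎
    where open ≡-Reasoning

sumList-++ : ∀ (xs ys : List ℚ) → sumList (xs ++ ys) ≡ sumList xs + sumList ys
sumList-++ []       ys = sym (+-identityˡ _)
sumList-++ (x ∷ xs) ys = trans (cong (x +_) (sumList-++ xs ys)) (sym (+-assoc x _ _))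

sumList-concatMap : ∀ {A : Set} (h : A → List ℚ) (xs : List A) →
                    sumList (concatMap h xs) ≡ sumList (List.map (λ a → sumList (h a)) xs)
sumList-concatMap h []       = refl
sumList-concatMap h (x ∷ xs) = trans (sumList-++ (h x) (concatMap h xs)) (cong (sumList (h x) +_) (sumList-concatMap h xs))

sumList-applyUpTo : ∀ (f : ℕ → ℚ) n → sumList (applyUpTo f n) ≡ Σ< n f
sumList-applyUpTo f zero    = refl
sumList-applyUpTo f (suc n) = trans (cong (f 0 +_) (sumList-applyUpTo (λ i → f (suc i)) n)) (sym (Σ<-head n f))

sumList-map-cong : ∀ {A : Set} {g h : A → ℚ} (xs : List A) → g ≗ h → sumList (List.map g xs) ≡ sumList (List.map h xs)
sumList-map-cong xs g≗h = cong sumList (List.map-cong g≗h xs)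

sumList-map-*ˡ : ∀ {A : Set} c (g : A → ℚ) (xs : List A) → sumList (List.map (λ a → c * g a) xs) ≡ c * sumList (List.map g xs)
sumList-map-*ˡ c g []       = sym (*-zeroʳ c)
sumList-map-*ˡ c g (x ∷ xs) = trans (cong (c * g x +_) (sumList-map-*ˡ c g xs)) (sym (*-distribˡ-+ c (g x) _))

sumList-map-*ʳ : ∀ {A : Set} c (g : A → ℚ) (xs : List A) → sumList (List.map (λ a → g a * c) xs) ≡ sumList (List.map g xs) * c
sumList-map-*ʳ c g xs = trans (sumList-map-cong xs (λ a → *-comm (g a) c)) (trans (sumList-map-*ˡ c g xs) (*-comm c _))

prodβ : ∀ {n} → Vec ℕ n → ℚ
prodβ = Vec.foldr _ (λ a r → β a * r) 1ℚ

sumList-prodβ-tuples : ∀ n l → sumList (List.map prodβ (tuples n l)) ≡ (β ^ₚ n) l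
sumList-prodβ-tuples zero    zero    = refl
sumList-prodβ-tuples zero    (suc l) = refl
sumList-prodβ-tuples (suc n) l = begin
  sumList (List.map prodβ (concatMap (λ a → List.map (a ∷_) (tuples n (l ∸ a))) (upTo (suc l))))
    ≡⟨ cong sumList (List.map-concatMap prodβ (λ a → List.map (a ∷_) (tuples n (l ∸ a))) (upTo (suc l))) ⟩
  sumList (concatMap (λ a → List.map prodβ (List.map (a ∷_) (tuples n (l ∸ a)))) (upTo (suc l)))
    ≡⟨ sumList-concatMap (λ a → List.map prodβ (List.map (a ∷_) (tuples n (l ∸ a)))) (upTo (suc l)) ⟩
  sumList (List.map (λ a → sumList (List.map prodβ (List.map (a ∷_) (tuples n (l ∸ a))))) (upTo (suc l)))
    ≡⟨ sumList-map-cong (upTo (suc l)) prepend ⟩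
  sumList (List.map (λ a → β a * (β ^ₚ n) (l ∸ a)) (upTo (suc l)))
    ≡⟨ cong sumList (List.map-upTo (λ a → β a * (β ^ₚ n) (l ∸ a)) (suc l)) ⟩
  sumList (applyUpTo (λ a → β a * (β ^ₚ n) (l ∸ a)) (suc l))
    ≡⟨ sumList-applyUpTo (λ a → β a * (β ^ₚ n) (l ∸ a)) (suc l) ⟩
  (β ^ₚ suc n) l
    ∎
  where
  open ≡-Reasoning
  prepend : ∀ a → sumList (List.map prodβ (List.map (a ∷_) (tuples n (l ∸ a)))) ≡ β a * (β ^ₚ n) (l ∸ a)
  prepend a = trans (cong sumList (sym (List.map-∘ (tuples n (l ∸ a)))))
                    (trans (sumList-map-*ˡ (β a) prodβ (tuples n (l ∸ a))) (cong (β a *_) (sumList-prodβ-tuples n (l ∸ a))))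

invℚ-prodFact*prodB : ∀ {n} (ls : Vec ℕ n) → invℚ (ℕtoℚ (prodFact ls)) * prodB ls ≡ prodβ ls
invℚ-prodFact*prodB []       = refl
invℚ-prodFact*prodB (a ∷ ls) = begin
  invℚ (ℕtoℚ (a ! ℕ.* prodFact ls)) * (B a * prodB ls)
    ≡⟨ cong (_* (B a * prodB ls)) (trans (cong invℚ (ℕtoℚ-homo-* (a !) (prodFact ls))) (invℚ-* (ℕtoℚ (a !)) _)) ⟩
  (invℚ (ℕtoℚ (a !)) * invℚ (ℕtoℚ (prodFact ls))) * ((ℕtoℚ (a !) * β a) * prodB ls)
    ≡⟨ solve 5 (λ i j f b p → (i :* j) :* ((f :* b) :* p) := (f :* i) :* b :* (j :* p))
               refl (invℚ (ℕtoℚ (a !))) (invℚ (ℕtoℚ (prodFact ls))) (ℕtoℚ (a !)) (β a) (prodB ls) ⟩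
  (ℕtoℚ (a !) * invℚ (ℕtoℚ (a !))) * β a * (invℚ (ℕtoℚ (prodFact ls)) * prodB ls)
    ≡⟨ cong₂ (λ u v → u * β a * v) (*-invℚʳ _ (ℕtoℚ-!≢0 a)) (invℚ-prodFact*prodB ls) ⟩
  1ℚ * β a * prodβ ls
    ≡⟨ cong (_* prodβ ls) (*-identityˡ (β a)) ⟩
  β a * prodβ ls
    ∎
  where open ≡-Reasoning

bernoulliSum : ℕ → ℕ → ℚ
bernoulliSum n l = sumList (List.map (λ ls → multinom (n ∸ 1) ls (n ∸ 1 ∸ l) * prodB ls) (tuples n l))

bernoulliSum≡stirling : ∀ p l → l ≤ p → bernoulliSum (suc p) l ≡ stirling (suc p) (suc p ∸ l)
bernoulliSum≡stirling p l l≤p = begin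
  bernoulliSum (suc p) l
    ≡⟨ sumList-map-cong (tuples (suc p) l) term ⟩
  sumList (List.map (λ ls → (P * Q⁻¹) * prodβ ls) (tuples (suc p) l))
    ≡⟨ sumList-map-*ˡ (P * Q⁻¹) prodβ (tuples (suc p) l) ⟩
  (P * Q⁻¹) * sumList (List.map prodβ (tuples (suc p) l))
    ≡⟨ cong ((P * Q⁻¹) *_) (sumList-prodβ-tuples (suc p) l) ⟩
  (P * Q⁻¹) * (β ^ₚ suc p) l
    ≡⟨ solve 3 (λ a i z → (a :* i) :* z := i :* (a :* z)) refl P Q⁻¹ ((β ^ₚ suc p) l) ⟩
  Q⁻¹ * (P * (β ^ₚ suc p) l)
    ≡⟨ cong (Q⁻¹ *_) (!*β^≡!*stirling p l q (ℕ.m+[n∸m]≡n l≤p)) ⟩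
  Q⁻¹ * (ℕtoℚ (q !) * stirling (suc p) (suc q))
    ≡⟨ *-assoc Q⁻¹ (ℕtoℚ (q !)) _ ⟨
  (Q⁻¹ * ℕtoℚ (q !)) * stirling (suc p) (suc q)
    ≡⟨ cong (_* stirling (suc p) (suc q)) (*-invℚˡ (ℕtoℚ (q !)) (ℕtoℚ-!≢0 q)) ⟩
  1ℚ * stirling (suc p) (suc q)
    ≡⟨ *-identityˡ _ ⟩
  stirling (suc p) (suc q)
    ≡⟨ cong (stirling (suc p)) (ℕ.+-∸-assoc 1 l≤p) ⟨
  stirling (suc p) (suc p ∸ l)
    ∎
  where
  open ≡-Reasoning
  q = p ∸ l
  P = ℕtoℚ (p !)
  Q⁻¹ = invℚ (ℕtoℚ (q !))
  term : ∀ ls → multinom p ls q * prodB ls ≡ (P * Q⁻¹) * prodβ ls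
  term ls = begin
    P * invℚ (ℕtoℚ (prodFact ls ℕ.* q !)) * prodB ls
      ≡⟨ cong (λ z → P * z * prodB ls) (trans (cong invℚ (ℕtoℚ-homo-* (prodFact ls) (q !))) (invℚ-* (ℕtoℚ (prodFact ls)) (ℕtoℚ (q !)))) ⟩
    P * (invℚ (ℕtoℚ (prodFact ls)) * Q⁻¹) * prodB ls
      ≡⟨ solve 4 (λ a i j b → a :* (i :* j) :* b := (a :* j) :* (i :* b)) refl P (invℚ (ℕtoℚ (prodFact ls))) Q⁻¹ (prodB ls) ⟩
    (P * Q⁻¹) * (invℚ (ℕtoℚ (prodFact ls)) * prodB ls)
      ≡⟨ cong ((P * Q⁻¹) *_) (invℚ-prodFact*prodB ls) ⟩
    (P * Q⁻¹) * prodβ ls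
      ∎

sign-pow : ∀ x j → powℚ (- x) j ≡ sign j * powℚ x j
sign-pow x zero    = refl
sign-pow x (suc j) = trans (cong ((- x) *_) (sign-pow x j))
  (solve 3 (λ x s q → (:- x) :* (s :* q) := (con (- 1ℚ) :* s) :* (x :* q)) refl x (sign j) (powℚ x j))

-- m! Lif_k(m) = 1/(m+1)ᵏ
Lif! : ℤ → ℕ → ℚ
Lif! k m = invℚ (powℤ (ℕtoℚ (m ℕ.+ 1)) k)

C≡cauchySum : ∀ k n x → C⁽ k ⁾ n x ≡ cauchySum x (Lif! k) n
C≡cauchySum k n x = begin
  ℕtoℚ (n !) * ((Lif k ∘ₚ log1+t) ⊛ binomPS (- x)) n
    ≡⟨ cong (ℕtoℚ (n !) *_) (∘ₚ-⊛ (Lif k) (binomPS (- x)) log1+t refl n) ⟩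
  ℕtoℚ (n !) * Σ< (suc n) (λ m → Lif k m * Λ x m n)
    ≡⟨ Σ<-*ˡ (suc n) (ℕtoℚ (n !)) _ ⟨
  Σ< (suc n) (λ m → ℕtoℚ (n !) * (Lif k m * Λ x m n))
    ≡⟨ Σ<-cong′ (suc n) term ⟩
  cauchySum x (Lif! k) n
    ∎
  where
  open ≡-Reasoning
  term : ∀ m → ℕtoℚ (n !) * (Lif k m * Λ x m n) ≡ Lif! k m * cauchyBasis x m n
  term m = begin
    ℕtoℚ (n !) * (invℚ (ℕtoℚ (m !) * powℤ (ℕtoℚ (suc m)) k) * Λ x m n)
      ≡⟨ cong (λ z → ℕtoℚ (n !) * (z * Λ x m n)) (invℚ-* (ℕtoℚ (m !)) _) ⟩
    ℕtoℚ (n !) * (invℚ (ℕtoℚ (m !)) * invℚ (powℤ (ℕtoℚ (1 ℕ.+ m)) k) * Λ x m n)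
      ≡⟨ cong (λ w → ℕtoℚ (n !) * (invℚ (ℕtoℚ (m !)) * invℚ (powℤ (ℕtoℚ w) k) * Λ x m n)) (ℕ.+-comm 1 m) ⟩
    ℕtoℚ (n !) * (invℚ (ℕtoℚ (m !)) * Lif! k m * Λ x m n)
      ≡⟨ solve 4 (λ f i a g → f :* (i :* a :* g) := a :* (f :* i :* g)) refl (ℕtoℚ (n !)) (invℚ (ℕtoℚ (m !))) (Lif! k m) (Λ x m n) ⟩
    Lif! k m * cauchyBasis x m n
      ∎

binomialSum-head : ∀ x c M → binomialSum x c M ≡ c M + Σ< M (λ j → ℕtoℚ (M C suc j) * powℚ (- x) (suc j) * c (M ∸ suc j))
binomialSum-head x c M = trans (Σ<-head M (λ j → ℕtoℚ (M C j) * powℚ (- x) j * c (M ∸ j))) (cong (_+ Σ< M (λ j → ℕtoℚ (M C suc j) * powℚ (- x) (suc j) * c (M ∸ suc j))) (*-identityˡ (c M)))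

stirlingSum-reverse : ∀ x c p → stirlingSum x c (suc p) ≡ Σ< (suc p) (λ l → stirling (suc p) (suc p ∸ l) * binomialSum x c (suc p ∸ l))
stirlingSum-reverse x c p = begin
  Σ< (suc (suc p)) f
    ≡⟨ Σ<-reverse (suc (suc p)) f ⟩
  Σ< (suc p) (λ l → f (suc p ∸ l)) + f (p ∸ p)
    ≡⟨ cong (λ z → Σ< (suc p) (λ l → f (suc p ∸ l)) + f z) (ℕ.n∸n≡0 p) ⟩
  Σ< (suc p) (λ l → f (suc p ∸ l)) + 0ℚ * binomialSum x c 0
    ≡⟨ solve 2 (λ s e → s :+ con 0ℚ :* e := s) refl (Σ< (suc p) (λ l → f (suc p ∸ l))) (binomialSum x c 0) ⟩
  Σ< (suc p) (λ l → f (suc p ∸ l))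
    ∎
  where
  open ≡-Reasoning
  f : ℕ → ℚ
  f M = stirling (suc p) M * binomialSum x c M

rhsConst≡ : ∀ k n → rhsConst k n ≡ Σ< n (λ l → bernoulliSum n l * Lif! k (n ∸ l))
rhsConst≡ k n = Σ<-cong′ n (λ l → sumList-map-*ʳ (Lif! k (n ∸ l)) (λ ls → multinom (n ∸ 1) ls (n ∸ 1 ∸ l) * prodB ls) (tuples n l))

rhsCoeff≡ : ∀ k n j → rhsCoeff k n j ≡ Σ< (n ∸ j ℕ.+ 1) (λ l → bernoulliSum n l * (sign j * ℕtoℚ ((n ∸ l) C j) * Lif! k (n ∸ l ∸ j)))
rhsCoeff≡ k n j = Σ<-cong′ (n ∸ j ℕ.+ 1) (λ l → trans
  (sumList-map-cong (tuples n l) (λ ls → solve 5 (λ s m c p q → s :* m :* c :* p :* q := (m :* p) :* (s :* c :* q))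
                                            refl (sign j) (multinom (n ∸ 1) ls (n ∸ 1 ∸ l)) (ℕtoℚ ((n ∸ l) C j)) (prodB ls) (Lif! k (n ∸ l ∸ j))))
  (sumList-map-*ʳ _ (λ ls → multinom (n ∸ 1) ls (n ∸ 1 ∸ l) * prodB ls) (tuples n l)))

stirlingSum≡rhs : ∀ k p x → stirlingSum x (Lif! k) (suc p) ≡ rhs k (suc p) x
stirlingSum≡rhs k p x = begin
  stirlingSum x a n
    ≡⟨ stirlingSum-reverse x a p ⟩
  Σ< n (λ l → stirling n (n ∸ l) * binomialSum x a (n ∸ l))
    ≡⟨ Σ<-cong n (λ l l<n → cong₂ _*_ (sym (bernoulliSum≡stirling p l (ℕ.≤-pred l<n))) (binomialSum-head x a (n ∸ l))) ⟩
  Σ< n (λ l → W l * (a (n ∸ l) + Σ< (n ∸ l) (t l)))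
    ≡⟨ trans (Σ<-cong′ n (λ l → *-distribˡ-+ (W l) _ _)) (Σ<-distrib-+ n _ _) ⟩
  Σ< n (λ l → W l * a (n ∸ l)) + Σ< n (λ l → W l * Σ< (n ∸ l) (t l))
    ≡⟨ cong₂ _+_ (sym (rhsConst≡ k n)) coefficients ⟩
  rhs k n x
    ∎
  where
  open ≡-Reasoning
  n = suc p
  a = Lif! k
  W = bernoulliSum n
  t : ℕ → ℕ → ℚ
  t l j = ℕtoℚ ((n ∸ l) C suc j) * powℚ (- x) (suc j) * a (n ∸ l ∸ suc j)
  coefficient : ∀ j → j < n → Σ< (n ∸ j) (λ l → W l * t l j) ≡ rhsCoeff k n (suc j) * powℚ x (suc j)
  coefficient j j<n = begin
    Σ< (n ∸ j) (λ l → W l * t l j)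
      ≡⟨ Σ<-cong′ (n ∸ j) (λ l → trans (cong (λ z → W l * (ℕtoℚ ((n ∸ l) C suc j) * z * a (n ∸ l ∸ suc j))) (sign-pow x (suc j)))
           (solve 5 (λ w c s q u → w :* (c :* (s :* q) :* u) := w :* (s :* c :* u) :* q)
                  refl (W l) (ℕtoℚ ((n ∸ l) C suc j)) (sign (suc j)) (powℚ x (suc j)) (a (n ∸ l ∸ suc j)))) ⟩
    Σ< (n ∸ j) (λ l → W l * (sign (suc j) * ℕtoℚ ((n ∸ l) C suc j) * a (n ∸ l ∸ suc j)) * powℚ x (suc j))
      ≡⟨ Σ<-*ʳ (n ∸ j) (powℚ x (suc j)) _ ⟩
    Σ< (n ∸ j) (λ l → W l * (sign (suc j) * ℕtoℚ ((n ∸ l) C suc j) * a (n ∸ l ∸ suc j))) * powℚ x (suc j)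
      ≡⟨ cong (λ z → Σ< z (λ l → W l * (sign (suc j) * ℕtoℚ ((n ∸ l) C suc j) * a (n ∸ l ∸ suc j))) * powℚ x (suc j))
              (trans (ℕ.+-∸-assoc 1 j<n) (ℕ.+-comm 1 (n ∸ suc j))) ⟩
    Σ< (n ∸ suc j ℕ.+ 1) (λ l → W l * (sign (suc j) * ℕtoℚ ((n ∸ l) C suc j) * a (n ∸ l ∸ suc j))) * powℚ x (suc j)
      ≡⟨ cong (_* powℚ x (suc j)) (rhsCoeff≡ k n (suc j)) ⟨
    rhsCoeff k n (suc j) * powℚ x (suc j)
      ∎
  coefficients : Σ< n (λ l → W l * Σ< (n ∸ l) (t l)) ≡ Σ< n (λ i → rhsCoeff k n (suc i) * powℚ x (suc i))
  coefficients = begin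
    Σ< n (λ l → W l * Σ< (n ∸ l) (t l))      ≡⟨ Σ<-cong′ n (λ l → sym (Σ<-*ˡ (n ∸ l) (W l) (t l))) ⟩
    Σ< n (λ l → Σ< (n ∸ l) (λ j → W l * t l j)) ≡⟨ Σ<-triangle-comm n (λ l j → W l * t l j) ⟩
    Σ< n (λ j → Σ< (n ∸ j) (λ l → W l * t l j)) ≡⟨ Σ<-cong n coefficient ⟩
    Σ< n (λ i → rhsCoeff k n (suc i) * powℚ x (suc i)) ∎

theorem1 : (k : ℤ) (n : ℕ) → 1 ≤ n → (x : ℚ) → C⁽ k ⁾ n x ≡ rhs k n x
theorem1 k (suc p) _ x = begin
  C⁽ k ⁾ (suc p) x                ≡⟨ C≡cauchySum k (suc p) x ⟩
  cauchySum x (Lif! k) (suc p)    ≡⟨ cauchySum≡stirlingSum x (suc p) (Lif! k) ⟩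
  stirlingSum x (Lif! k) (suc p)  ≡⟨ stirlingSum≡rhs k p x ⟩
  rhs k (suc p) x                 ∎
  where open ≡-Reasoning
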